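{- Let $G=G_1\oplus G_2$, let $R_1,\dots,R_n,W_1,\dots,W_m,H,H_1\in G_1$ and $X_1,\dots,X_{m+2}\in G_2$, with $R=(R_1,\dots,R_n)$, $W=(W_1,\dots,W_m)$, $X=(X_1,\dots,X_{m+2})$. Assume: (i) $R_1\cdots R_n=1$; (ii) $H\in\langle R_1,\dots,R_n,W_1,\dots,W_m\rangle$; (iii) $X_i\neq1$ for every $i$; (iv) the stabilizer of $(X_1,\dots,X_{m+2})$ under the Hurwitz braid action is contained in the stabilizer of $(W_1,\dots,W_m,H^{ -1},H)$ (both subgroups of $B_{m+2}$). Then the normal closure of $\{R_1,\dots,R_n\}$ in $\langle R_1,\dots,R_n,W_1,\dots,W_m\rangle$ contains an element $Y$ with $H^Y=H_1$ if and only if $P_X(R,W,H)$ and $P_X(R,W,H_1)$ are Hurwitz equivalent.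
   Context: Conjugation notation: $a^b=b^{ -1}ab$. $P_X(R,W,H)$ denotes the factorization in $G_1\oplus G_2$ given by $((R_1,1),\dots,(R_n,1),(W_1,X_1),\dots,(W_m,X_m),(H^{ -1},X_{m+1}),(H,X_{m+2}))$. The braid group $B_k$ (generators $\sigma_1,\dots,\sigma_{k-1}$) acts on the right on tuples of group elements by $(f_1,\dots,f_k)\sigma_i=(f_1,\dots,f_{i-1},f_{i+1},f_{i+1}^{ -1}f_if_{i+1},f_{i+2},\dots,f_k)$, $(f_1,\dots,f_k)\sigma_i^{ -1}=(f_1,\dots,f_{i-1},f_if_{i+1}f_i^{ -1},f_i,f_{i+2},\dots,f_k)$ (Hurwitz braid action); Hurwitz equivalent means in the same orbit. -}

module Defs where

open import Level using (Level; _⊔_)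
open import Algebra.Bundles using (Group)
open import Data.Nat using (ℕ; suc; _+_)
open import Data.Fin using (Fin)
open import Data.Bool using (Bool; true; false)
open import Data.List using (List; []; _∷_)
open import Data.Product using (_×_; _,_; ∃; ∃-syntax)
open import Data.Sum using (_⊎_)
open import Data.Vec using (Vec; []; _∷_; _++_; lookup; map; zipWith)
open import Data.Vec.Relation.Binary.Pointwise.Inductive using (Pointwise)
open import Function.Bundles using (_⇔_)
open import Relation.Nullary using (¬_)
import Algebra.Construct.DirectProduct as DP

-- Standard Artin generators of the braid group on k strands:
-- here = σ₁ (acting on positions 1,2), there i = σ_{i+1}.
data BGen : ℕ → Set where
  here  : ∀ {k} → BGen (suc (suc k))
  there : ∀ {k} → BGen k → BGen (suc k)

-- A braid word: list of generators with sign (true = σ_i, false = σ_i⁻¹).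
BraidWord : ℕ → Set
BraidWord k = List (BGen k × Bool)

module GroupDefs {c ℓ} (G : Group c ℓ) where
  open Group G

  _^_ : Carrier → Carrier → Carrier
  a ^ b = b ⁻¹ ∙ a ∙ b

  prod : ∀ {k} → Vec Carrier k → Carrier
  prod []       = ε
  prod (x ∷ xs) = x ∙ prod xs

  data Gen {p} (P : Carrier → Set p) : Carrier → Set (c ⊔ ℓ ⊔ p) where
    gen  : ∀ {x} → P x → Gen P x
    unit : Gen P ε
    inv  : ∀ {x} → Gen P x → Gen P (x ⁻¹)
    mul  : ∀ {x y} → Gen P x → Gen P y → Gen P (x ∙ y)
    resp : ∀ {x y} → x ≈ y → Gen P x → Gen P y

  Span : ∀ {n m} → Vec Carrier n → Vec Carrier m → Carrier → Set (c ⊔ ℓ)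
  Span R W = Gen (λ g → (∃[ i ] (lookup R i ≈ g)) ⊎ (∃[ j ] (lookup W j ≈ g)))

  NormalClosure : ∀ {n m} → Vec Carrier n → Vec Carrier m → Carrier → Set (c ⊔ ℓ)
  NormalClosure R W = Gen (λ y → ∃[ i ] ∃[ k ] (Span R W k × (y ≈ (lookup R i ^ k))))

  σ : ∀ {k} → BGen k → Vec Carrier k → Vec Carrier k
  σ here      (f ∷ g ∷ v) = g ∷ (f ^ g) ∷ v
  σ (there i) (f ∷ v)     = f ∷ σ i v

  σ⁻ : ∀ {k} → BGen k → Vec Carrier k → Vec Carrier k
  σ⁻ here      (f ∷ g ∷ v) = (f ∙ g ∙ f ⁻¹) ∷ f ∷ v
  σ⁻ (there i) (f ∷ v)     = f ∷ σ⁻ i v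

  act : ∀ {k} → BraidWord k → Vec Carrier k → Vec Carrier k
  act []                 v = v
  act ((i , true)  ∷ w)  v = act w (σ i v)
  act ((i , false) ∷ w)  v = act w (σ⁻ i v)

  _≋_ : ∀ {k} → Vec Carrier k → Vec Carrier k → Set (c ⊔ ℓ)
  _≋_ = Pointwise _≈_

  Stabilizes : ∀ {k} → BraidWord k → Vec Carrier k → Set (c ⊔ ℓ)
  Stabilizes w v = act w v ≋ v

  HurwitzEquivalent : ∀ {k} → Vec Carrier k → Vec Carrier k → Set (c ⊔ ℓ)
  HurwitzEquivalent u v = ∃[ w ] (act w u ≋ v)

module _ {c₁ ℓ₁ c₂ ℓ₂} (G₁ : Group c₁ ℓ₁) (G₂ : Group c₂ ℓ₂) where
  private
    module A = Group G₁
    module B = Group G₂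

  G₁⊕G₂ : Group (c₁ ⊔ c₂) (ℓ₁ ⊔ ℓ₂)
  G₁⊕G₂ = DP.group G₁ G₂

  P : ∀ {n m} → Vec A.Carrier n → Vec A.Carrier m → Vec B.Carrier (m + 2)
      → A.Carrier → Vec (A.Carrier × B.Carrier) (n + (m + 2))
  P R W X H = map (λ r → (r , B.ε)) R ++ zipWith _,_ (W ++ (H A.⁻¹ ∷ H ∷ [])) X

module Submission where

-- (⇒) The normal closure of R in ⟨R,W⟩ is generated by the conjugates R_i^v with v ∈ ⟨W⟩.
-- Since R₁⋯Rₙ = 1 and the second coordinates of the relator strands are trivial, the block
-- (R₁,1),…,(Rₙ,1) slides past any strand unchanged and can be conjugated by the first
-- coordinate of any strand (W_j,X_j), hence by any v ∈ ⟨W⟩.  Looping the last pair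
-- (H⁻¹,X_{m+1}),(H,X_{m+2}) once around the strand (R_i^v,1) replaces H by H^{R_i^v};
-- undoing the other moves then realises every generator, and so every Y, by a braid.
-- (⇐) Follow the strands through a braid taking P_X(R,W,H) to P_X(R,W,H₁).  Strands with
-- trivial G₂-coordinate carry elements of the normal closure N, and every other strand
-- carries the entry it would have under the braid induced on these strands alone, conjugated
-- by an element of N.  As the X_i are nontrivial, every strand type ends where it started, so
-- the induced braid stabilises X, hence by (iv) also (W,H⁻¹,H), and the last entry gives H₁ = H^Y.

open import Level using (_⊔_; Lift; lift)
open import Algebra.Bundles using (Group)
import Algebra.Properties.Group as GroupProperties
import Algebra.Solver.Monoid as MonoidSolver
open import Data.Bool using (Bool; true; false; not)
open import Data.Nat using (ℕ; zero; suc; _+_)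
open import Data.Product using (_×_; _,_; proj₁; proj₂; Σ; ∃; ∃-syntax)
open import Data.Empty using (⊥-elim)
open import Data.Unit using (⊤; tt)
open import Data.Sum using (inj₁; inj₂)
open import Data.Vec using (Vec; lookup)
open import Relation.Nullary using (¬_)
open import Relation.Binary.PropositionalEquality as ≡ using (_≡_; cong; cong₂)
open import Defs

module Conjugation {c ℓ} (K : Group c ℓ) where
  open Group K
  open GroupDefs K using (_^_; Gen; gen; unit; inv; mul; resp)
  open GroupProperties K using (ε⁻¹≈ε; ⁻¹-involutive; ⁻¹-anti-homo-∙)
  open MonoidSolver monoid using (solve; _⊜_; _⊕_)
  open import Relation.Binary.Reasoning.Setoid setoid

  ^-cong : ∀ {a a′ b b′} → a ≈ a′ → b ≈ b′ → a ^ b ≈ a′ ^ b′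
  ^-cong a≈a′ b≈b′ = ∙-cong (∙-cong (⁻¹-cong b≈b′) a≈a′) b≈b′

  ^-identityʳ : ∀ a → a ^ ε ≈ a
  ^-identityʳ a = begin
    ε ⁻¹ ∙ a ∙ ε  ≈⟨ identityʳ _ ⟩
    ε ⁻¹ ∙ a      ≈⟨ ∙-congʳ ε⁻¹≈ε ⟩
    ε ∙ a         ≈⟨ identityˡ a ⟩
    a             ∎

  ε-^ : ∀ x → ε ^ x ≈ ε
  ε-^ x = trans (∙-congʳ (identityʳ _)) (inverseˡ x)

  ^-≈ε : ∀ {a x} → x ≈ ε → a ^ x ≈ a
  ^-≈ε {a} x≈ε = trans (^-cong refl x≈ε) (^-identityʳ a)

  ^-∙ : ∀ a x y → a ^ (x ∙ y) ≈ (a ^ x) ^ y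
  ^-∙ a x y = begin
    (x ∙ y) ⁻¹ ∙ a ∙ (x ∙ y)     ≈⟨ ∙-congʳ (∙-congʳ (⁻¹-anti-homo-∙ x y)) ⟩
    y ⁻¹ ∙ x ⁻¹ ∙ a ∙ (x ∙ y)    ≈⟨ solve 5 (λ y′ x′ a x y → ((y′ ⊕ x′) ⊕ a) ⊕ (x ⊕ y)
                                                     ⊜ (y′ ⊕ ((x′ ⊕ a) ⊕ x)) ⊕ y)
                                          refl (y ⁻¹) (x ⁻¹) a x y ⟩
    y ⁻¹ ∙ (x ⁻¹ ∙ a ∙ x) ∙ y    ∎

  ^-distrib-∙ : ∀ a b x → (a ∙ b) ^ x ≈ (a ^ x) ∙ (b ^ x)
  ^-distrib-∙ a b x = begin
    x ⁻¹ ∙ (a ∙ b) ∙ x                ≈⟨ ∙-congʳ (∙-congˡ (∙-congʳ (//-rightDividesʳ x a))) ⟨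
    x ⁻¹ ∙ (a ∙ x ∙ x ⁻¹ ∙ b) ∙ x     ≈⟨ solve 5 (λ x′ a x x″ b → (x′ ⊕ (((a ⊕ x) ⊕ x″) ⊕ b)) ⊕ x
                                                          ⊜ ((x′ ⊕ a) ⊕ x) ⊕ ((x″ ⊕ b) ⊕ x))
                                               refl (x ⁻¹) a x (x ⁻¹) b ⟩
    x ⁻¹ ∙ a ∙ x ∙ (x ⁻¹ ∙ b ∙ x)     ∎
    where open GroupProperties K using (//-rightDividesʳ)

  ^-distrib-⁻¹ : ∀ a x → (a ⁻¹) ^ x ≈ (a ^ x) ⁻¹
  ^-distrib-⁻¹ a x = begin
    x ⁻¹ ∙ a ⁻¹ ∙ x             ≈⟨ assoc _ _ _ ⟩
    x ⁻¹ ∙ (a ⁻¹ ∙ x)           ≈⟨ ∙-congˡ (∙-congˡ (⁻¹-involutive x)) ⟨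
    x ⁻¹ ∙ (a ⁻¹ ∙ x ⁻¹ ⁻¹)     ≈⟨ ∙-congˡ (⁻¹-anti-homo-∙ _ _) ⟨
    x ⁻¹ ∙ (x ⁻¹ ∙ a) ⁻¹        ≈⟨ ⁻¹-anti-homo-∙ _ _ ⟨
    (x ⁻¹ ∙ a ∙ x) ⁻¹           ∎

  ^-^⁻¹ : ∀ a x → (a ^ x) ^ (x ⁻¹) ≈ a
  ^-^⁻¹ a x = trans (sym (^-∙ a x (x ⁻¹))) (^-≈ε (inverseʳ x))

  ^⁻¹-^ : ∀ a x → (a ^ (x ⁻¹)) ^ x ≈ a
  ^⁻¹-^ a x = trans (sym (^-∙ a (x ⁻¹) x)) (^-≈ε (inverseˡ x))

  ∙-∙⁻¹≈^⁻¹ : ∀ f g → f ∙ g ∙ f ⁻¹ ≈ g ^ (f ⁻¹)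
  ∙-∙⁻¹≈^⁻¹ f g = ∙-congʳ (∙-congʳ (sym (⁻¹-involutive f)))

  Gen-^ : ∀ {p} {P : Carrier → Set p} {z} → (∀ {x} → P x → Gen P (x ^ z)) → ∀ {x} → Gen P x → Gen P (x ^ z)
  Gen-^ P-^ (gen px)            = P-^ px
  Gen-^ P-^ unit                = resp (sym (ε-^ _)) unit
  Gen-^ P-^ (inv {x} gx)        = resp (sym (^-distrib-⁻¹ x _)) (inv (Gen-^ P-^ gx))
  Gen-^ P-^ (mul {x} {y} gx gy) = resp (sym (^-distrib-∙ x y _)) (mul (Gen-^ P-^ gx) (Gen-^ P-^ gy))
  Gen-^ P-^ (resp x≈y gx)       = resp (^-cong x≈y refl) (Gen-^ P-^ gx)

module Closures {c ℓ} (K : Group c ℓ) {n m} (R : Vec (Group.Carrier K) n) (W : Vec (Group.Carrier K) m) where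
  open Group K
  open GroupDefs K using (_^_; Gen; gen; unit; inv; mul; resp; Span; NormalClosure)
  open GroupProperties K using (ε⁻¹≈ε; ⁻¹-involutive; ⁻¹-anti-homo-∙)
  open Conjugation K

  WSpan : Carrier → Set (c ⊔ ℓ)
  WSpan = Gen (λ g → ∃[ j ] (lookup W j ≈ g))

  WConjugateClosure : Carrier → Set (c ⊔ ℓ)
  WConjugateClosure = Gen (λ y → ∃[ i ] ∃[ v ] (WSpan v × y ≈ lookup R i ^ v))

  Span-R : ∀ i → Span R W (lookup R i)
  Span-R i = gen (inj₁ (i , refl))

  Span-^ : ∀ {a b} → Span R W a → Span R W b → Span R W (a ^ b)
  Span-^ sa sb = mul (mul (inv sb) sa) sb

  NormalClosure⊆Span : ∀ {x} → NormalClosure R W x → Span R W x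
  NormalClosure⊆Span (gen (i , k , sk , x≈)) = resp (sym x≈) (Span-^ (Span-R i) sk)
  NormalClosure⊆Span unit                    = unit
  NormalClosure⊆Span (inv nx)                = inv (NormalClosure⊆Span nx)
  NormalClosure⊆Span (mul nx ny)             = mul (NormalClosure⊆Span nx) (NormalClosure⊆Span ny)
  NormalClosure⊆Span (resp x≈y nx)           = resp x≈y (NormalClosure⊆Span nx)

  NormalClosure-^ : ∀ {x z} → NormalClosure R W x → Span R W z → NormalClosure R W (x ^ z)
  NormalClosure-^ {z = z} nx sz = Gen-^ generator-^ nx
    where
    generator-^ : ∀ {x} → ∃[ i ] ∃[ k ] (Span R W k × x ≈ lookup R i ^ k) → NormalClosure R W (x ^ z)
    generator-^ (i , k , sk , x≈) = gen (i , k ∙ z , mul sk sz , trans (^-cong x≈ refl) (sym (^-∙ _ k z)))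

  WConjugateClosure-R : ∀ i → WConjugateClosure (lookup R i)
  WConjugateClosure-R i = gen (i , ε , unit , sym (^-identityʳ _))

  WConjugateClosure-^W : ∀ {y v} → WConjugateClosure y → WSpan v → WConjugateClosure (y ^ v)
  WConjugateClosure-^W {v = v} ny wv = Gen-^ generator-^ ny
    where
    generator-^ : ∀ {y} → ∃[ i ] ∃[ u ] (WSpan u × y ≈ lookup R i ^ u) → WConjugateClosure (y ^ v)
    generator-^ (i , u , wu , y≈) = gen (i , u ∙ v , mul wu wv , trans (^-cong y≈ refl) (sym (^-∙ _ u v)))

  -- Conjugation by k⁻¹ is carried along so that the inv case of the induction goes through.
  WConjugateClosure-^ : ∀ {k} → Span R W k → ∀ {a} → WConjugateClosure a →
                        WConjugateClosure (a ^ k) × WConjugateClosure (a ^ (k ⁻¹))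
  WConjugateClosure-^ (gen (inj₁ (l , R≈))) na =
    resp (^-cong refl R≈) (conjugate-within na (WConjugateClosure-R l)) ,
    resp (^-cong refl (⁻¹-cong R≈)) (conjugate-within na (inv (WConjugateClosure-R l)))
    where
    conjugate-within : ∀ {y x} → WConjugateClosure y → WConjugateClosure x → WConjugateClosure (y ^ x)
    conjugate-within ny nx = mul (mul (inv nx) ny) nx
  WConjugateClosure-^ (gen (inj₂ (l , W≈))) na =
    WConjugateClosure-^W na (gen (l , W≈)) , WConjugateClosure-^W na (inv (gen (l , W≈)))
  WConjugateClosure-^ unit {a} na =
    resp (sym (^-identityʳ a)) na , resp (sym (trans (^-cong refl ε⁻¹≈ε) (^-identityʳ a))) na
  WConjugateClosure-^ (inv {x} sx) na =
    proj₂ (WConjugateClosure-^ sx na) , resp (^-cong refl (sym (⁻¹-involutive x))) (proj₁ (WConjugateClosure-^ sx na))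
  WConjugateClosure-^ (mul {x} {y} sx sy) {a} na =
    resp (sym (^-∙ a x y)) (proj₁ (WConjugateClosure-^ sy (proj₁ (WConjugateClosure-^ sx na)))) ,
    resp (trans (sym (^-∙ a (y ⁻¹) (x ⁻¹))) (^-cong refl (sym (⁻¹-anti-homo-∙ x y))))
         (proj₂ (WConjugateClosure-^ sx (proj₂ (WConjugateClosure-^ sy na))))
  WConjugateClosure-^ (resp x≈y sx) na =
    resp (^-cong refl x≈y) (proj₁ (WConjugateClosure-^ sx na)) ,
    resp (^-cong refl (⁻¹-cong x≈y)) (proj₂ (WConjugateClosure-^ sx na))

  NormalClosure⊆WConjugateClosure : ∀ {y} → NormalClosure R W y → WConjugateClosure y
  NormalClosure⊆WConjugateClosure (gen (i , k , sk , y≈)) = resp (sym y≈) (proj₁ (WConjugateClosure-^ sk (WConjugateClosure-R i)))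
  NormalClosure⊆WConjugateClosure unit                    = unit
  NormalClosure⊆WConjugateClosure (inv ny)                = inv (NormalClosure⊆WConjugateClosure ny)
  NormalClosure⊆WConjugateClosure (mul nx ny)             = mul (NormalClosure⊆WConjugateClosure nx) (NormalClosure⊆WConjugateClosure ny)
  NormalClosure⊆WConjugateClosure (resp x≈y ny)           = resp x≈y (NormalClosure⊆WConjugateClosure ny)

-- Hurwitz action on lists

module HurwitzAction where
  open import Data.List using (List; []; _∷_; _++_; length; map; foldl; foldr; replicate)
  open import Data.List.Properties using (length-map; length-++; ++-assoc; map-++; map-∘)
  import Data.Vec.Properties as VecProperties
  open VecProperties using (length-toList)
  import Data.List.Relation.Binary.Equality.Setoid as ListEquality
  open import Data.List.Membership.Propositional using (_∈_)
  open import Data.List.Membership.Propositional.Properties using (∈-∃++)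
  open import Data.Product using (map₁)
  import Data.Vec as V
  open import Data.Vec.Membership.Propositional using () renaming (_∈_ to _∈ᵥ_)
  open import Data.Vec.Membership.Propositional.Properties using (∈-lookup; ∈-toList⁺)

  -- (p , true) is σ_{p+1} and (p , false) its inverse; letters beyond the end of a list act trivially.
  Word : Set
  Word = List (ℕ × Bool)

  shift : ℕ → Word → Word
  shift n = map (map₁ (n +_))

  invert : Word → Word
  invert []            = []
  invert ((p , b) ∷ w) = invert w ++ (p , not b) ∷ []

  module OnLists {c ℓ} (K : Group c ℓ) where
    open Group K
    open GroupDefs K using (_^_)
    open Conjugation K
    open ListEquality setoid public using ([]; _∷_; _≋_; ≋-refl; ≋-reflexive; ≋-sym; ≋-trans; ++⁺; ++⁺ˡ; ≋-setoid)

    σL σL⁻ : ℕ → List Carrier → List Carrier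
    σL zero    (f ∷ g ∷ v) = g ∷ f ^ g ∷ v
    σL (suc p) (f ∷ v)     = f ∷ σL p v
    σL _       v           = v
    σL⁻ zero    (f ∷ g ∷ v) = f ∙ g ∙ f ⁻¹ ∷ f ∷ v
    σL⁻ (suc p) (f ∷ v)     = f ∷ σL⁻ p v
    σL⁻ _       v           = v

    letter : ℕ × Bool → List Carrier → List Carrier
    letter (p , true)  = σL p
    letter (p , false) = σL⁻ p

    actL : Word → List Carrier → List Carrier
    actL []      v = v
    actL (x ∷ w) v = actL w (letter x v)

    σL-cong : ∀ p {u v} → u ≋ v → σL p u ≋ σL p v
    σL-cong zero    []                = []
    σL-cong zero    (f ∷ [])          = f ∷ []
    σL-cong zero    (f ∷ g ∷ fs)      = g ∷ ^-cong f g ∷ fs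
    σL-cong (suc p) []                = []
    σL-cong (suc p) (f ∷ fs)          = f ∷ σL-cong p fs

    σL⁻-cong : ∀ p {u v} → u ≋ v → σL⁻ p u ≋ σL⁻ p v
    σL⁻-cong zero    []               = []
    σL⁻-cong zero    (f ∷ [])         = f ∷ []
    σL⁻-cong zero    (f ∷ g ∷ fs)     = ∙-cong (∙-cong f g) (⁻¹-cong f) ∷ f ∷ fs
    σL⁻-cong (suc p) []               = []
    σL⁻-cong (suc p) (f ∷ fs)         = f ∷ σL⁻-cong p fs

    letter-cong : ∀ x {u v} → u ≋ v → letter x u ≋ letter x v
    letter-cong (p , true)  = σL-cong p
    letter-cong (p , false) = σL⁻-cong p

    actL-cong : ∀ w {u v} → u ≋ v → actL w u ≋ actL w v
    actL-cong []      u≋v = u≋v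
    actL-cong (x ∷ w) u≋v = actL-cong w (letter-cong x u≋v)

    actL-++ : ∀ w w′ v → actL (w ++ w′) v ≡ actL w′ (actL w v)
    actL-++ []      w′ v = ≡.refl
    actL-++ (x ∷ w) w′ v = actL-++ w w′ (letter x v)

    σL⁻-σL : ∀ p v → σL⁻ p (σL p v) ≋ v
    σL⁻-σL zero    []          = []
    σL⁻-σL zero    (f ∷ [])    = refl ∷ []
    σL⁻-σL zero    (f ∷ g ∷ v) = g∙f^g∙g⁻¹≈f ∷ refl ∷ ≋-refl
      where
      open GroupProperties K using (\\-leftDividesˡ; //-rightDividesʳ)
      g∙f^g∙g⁻¹≈f : g ∙ f ^ g ∙ g ⁻¹ ≈ f
      g∙f^g∙g⁻¹≈f = trans (∙-congʳ (trans (∙-congˡ (assoc _ _ _)) (\\-leftDividesˡ g (f ∙ g))))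
                          (//-rightDividesʳ g f)
    σL⁻-σL (suc p) []          = []
    σL⁻-σL (suc p) (f ∷ v)     = refl ∷ σL⁻-σL p v

    σL-σL⁻ : ∀ p v → σL p (σL⁻ p v) ≋ v
    σL-σL⁻ zero    []          = []
    σL-σL⁻ zero    (f ∷ [])    = refl ∷ []
    σL-σL⁻ zero    (f ∷ g ∷ v) = refl ∷ trans (^-cong (∙-∙⁻¹≈^⁻¹ f g) refl) (^⁻¹-^ g f) ∷ ≋-refl
    σL-σL⁻ (suc p) []          = []
    σL-σL⁻ (suc p) (f ∷ v)     = refl ∷ σL-σL⁻ p v

    actL-invert : ∀ w {u v} → actL w u ≋ v → actL (invert w) v ≋ u
    actL-invert w {u} {v} wu≋v = ≋-trans (actL-cong (invert w) (≋-sym wu≋v)) (cancel w u)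
      where
      letter-flip : ∀ p b v → letter (p , not b) (letter (p , b) v) ≋ v
      letter-flip p true  = σL⁻-σL p
      letter-flip p false = σL-σL⁻ p
      cancel : ∀ w u → actL (invert w) (actL w u) ≋ u
      cancel []            u = ≋-refl
      cancel ((p , b) ∷ w) u = begin
        actL (invert w ++ (p , not b) ∷ []) (actL w (letter (p , b) u))   ≡⟨ actL-++ (invert w) _ _ ⟩
        letter (p , not b) (actL (invert w) (actL w (letter (p , b) u)))  ≈⟨ letter-cong (p , not b) (cancel w _) ⟩
        letter (p , not b) (letter (p , b) u)                             ≈⟨ letter-flip p b u ⟩
        u                                                                 ∎
        where open import Relation.Binary.Reasoning.Setoid ≋-setoid

    actL-shift : ∀ (u : List Carrier) w v → actL (shift (length u) w) (u ++ v) ≡ u ++ actL w v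
    actL-shift u []      v = ≡.refl
    actL-shift u (x ∷ w) v = ≡.trans (cong (actL (shift (length u) w)) (letter-shift u x v)) (actL-shift u w (letter x v))
      where
      σL-shift : ∀ (u : List Carrier) p v → σL (length u + p) (u ++ v) ≡ u ++ σL p v
      σL-shift []      p v = ≡.refl
      σL-shift (f ∷ u) p v = cong (f ∷_) (σL-shift u p v)
      σL⁻-shift : ∀ (u : List Carrier) p v → σL⁻ (length u + p) (u ++ v) ≡ u ++ σL⁻ p v
      σL⁻-shift []      p v = ≡.refl
      σL⁻-shift (f ∷ u) p v = cong (f ∷_) (σL⁻-shift u p v)
      letter-shift : ∀ (u : List Carrier) x v → letter (map₁ (length u +_) x) (u ++ v) ≡ u ++ letter x v
      letter-shift u (p , true)  = σL-shift u p
      letter-shift u (p , false) = σL⁻-shift u p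

    infix 4 _∼_
    _∼_ : List Carrier → List Carrier → Set (c ⊔ ℓ)
    u ∼ v = ∃[ ω ] (actL ω u ≋ v)

    ∼-refl : ∀ {u} → u ∼ u
    ∼-refl = [] , ≋-refl

    ∼-sym : ∀ {u v} → u ∼ v → v ∼ u
    ∼-sym (ω , ωu≋v) = invert ω , actL-invert ω ωu≋v

    ∼-trans : ∀ {u v w} → u ∼ v → v ∼ w → u ∼ w
    ∼-trans {u} (ω , ωu≋v) (ω′ , ω′v≋w) =
      ω ++ ω′ , ≋-trans (≋-reflexive (actL-++ ω ω′ u)) (≋-trans (actL-cong ω′ ωu≋v) ω′v≋w)

    ∼-respˡ : ∀ {u u′ v} → u ≋ u′ → u ∼ v → u′ ∼ v
    ∼-respˡ u≋u′ (ω , ωu≋v) = ω , ≋-trans (actL-cong ω (≋-sym u≋u′)) ωu≋v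

    ∼-respʳ : ∀ {u v v′} → v ≋ v′ → u ∼ v → u ∼ v′
    ∼-respʳ v≋v′ (ω , ωu≋v) = ω , ≋-trans ωu≋v v≋v′

  module Nontriviality {c ℓ} (K : Group c ℓ) where
    open Group K
    open GroupDefs K using (_^_)
    open Conjugation K
    open OnLists K
    open import Data.List.Relation.Unary.All using (All; []; _∷_)

    NonTrivial : Carrier → Set ℓ
    NonTrivial x = ¬ x ≈ ε

    ^-nonTrivial : ∀ {f} g → NonTrivial f → NonTrivial (f ^ g)
    ^-nonTrivial {f} g f≉ε f^g≈ε = f≉ε (trans (sym (^-^⁻¹ f g)) (trans (^-cong f^g≈ε refl) (ε-^ (g ⁻¹))))

    σL-nonTrivial : ∀ p {v} → All NonTrivial v → All NonTrivial (σL p v)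
    σL-nonTrivial zero    []                   = []
    σL-nonTrivial zero    (nf ∷ [])            = nf ∷ []
    σL-nonTrivial zero    {f ∷ g ∷ v} (nf ∷ ng ∷ nv) = ng ∷ ^-nonTrivial g nf ∷ nv
    σL-nonTrivial (suc p) []                   = []
    σL-nonTrivial (suc p) (nf ∷ nv)            = nf ∷ σL-nonTrivial p nv

    σL⁻-nonTrivial : ∀ p {v} → All NonTrivial v → All NonTrivial (σL⁻ p v)
    σL⁻-nonTrivial zero    []                  = []
    σL⁻-nonTrivial zero    (nf ∷ [])           = nf ∷ []
    σL⁻-nonTrivial zero    {f ∷ g ∷ v} (nf ∷ ng ∷ nv) =
      (λ fgf⁻¹≈ε → ^-nonTrivial (f ⁻¹) ng (trans (sym (∙-∙⁻¹≈^⁻¹ f g)) fgf⁻¹≈ε)) ∷ nf ∷ nv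
    σL⁻-nonTrivial (suc p) []                  = []
    σL⁻-nonTrivial (suc p) (nf ∷ nv)           = nf ∷ σL⁻-nonTrivial p nv

    actL-nonTrivial : ∀ w {v} → All NonTrivial v → All NonTrivial (actL w v)
    actL-nonTrivial []                nv = nv
    actL-nonTrivial ((p , true) ∷ w)  nv = actL-nonTrivial w (σL-nonTrivial p nv)
    actL-nonTrivial ((p , false) ∷ w) nv = actL-nonTrivial w (σL⁻-nonTrivial p nv)

  -- Braid moves

  sweep⁺ sweep⁻ : ℕ → Word
  sweep⁺ zero    = []
  sweep⁺ (suc n) = (0 , true) ∷ shift 1 (sweep⁺ n)
  sweep⁻ zero    = []
  sweep⁻ (suc n) = (0 , false) ∷ shift 1 (sweep⁻ n)

  passBlock : ℕ → ℕ → Word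
  passBlock n zero    = []
  passBlock n (suc k) = invert (sweep⁺ n) ++ shift 1 (passBlock n k)

  transported : ℕ → ℕ → Word → Word
  transported n k w = passBlock n k ++ shift k w ++ invert (passBlock n k)

  conjugateBlock : ℕ → Word
  conjugateBlock n = invert (sweep⁻ n) ++ sweep⁺ n

  pairLeft : ℕ → Word
  pairLeft zero    = []
  pairLeft (suc k) = shift 1 (pairLeft k) ++ (0 , true) ∷ (1 , true) ∷ []

  -- σ₁σ₂σ₂σ₁: the first strand travels once around the next two.
  pairLoop : Word
  pairLoop = (0 , true) ∷ (1 , true) ∷ (1 , true) ∷ (0 , true) ∷ []

  conjugatePair : ℕ → Word
  conjugatePair k = shift 1 (pairLeft k) ++ pairLoop ++ invert (shift 1 (pairLeft k))

  module Moves {c ℓ} (K : Group c ℓ) where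
    open Group K
    open GroupDefs K using (_^_)
    open Conjugation K
    open OnLists K
    open import Relation.Binary.Reasoning.Setoid ≋-setoid

    ∏ : List Carrier → Carrier
    ∏ = foldr _∙_ ε

    prod≡∏ : ∀ {k} (v : Vec Carrier k) → GroupDefs.prod K v ≡ ∏ (V.toList v)
    prod≡∏ V.[]      = ≡.refl
    prod≡∏ (x V.∷ v) = cong (x ∙_) (prod≡∏ v)

    ∏-map-^ : ∀ x T → ∏ (map (_^ x) T) ≈ ∏ T ^ x
    ∏-map-^ x []      = sym (ε-^ x)
    ∏-map-^ x (t ∷ T) = trans (∙-congˡ (∏-map-^ x T)) (sym (^-distrib-∙ t (∏ T) x))

    ∏-map-^-≈ε : ∀ x {T} → ∏ T ≈ ε → ∏ (map (_^ x) T) ≈ ε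
    ∏-map-^-≈ε x {T} ∏T≈ε = trans (∏-map-^ x T) (trans (^-cong ∏T≈ε refl) (ε-^ x))

    foldl-^ : ∀ e T → foldl _^_ e T ≈ e ^ ∏ T
    foldl-^ e []      = sym (^-identityʳ e)
    foldl-^ e (t ∷ T) = trans (foldl-^ (e ^ t) T) (sym (^-∙ e t (∏ T)))

    map-≈ : ∀ {a} {A : Set a} {f g : A → Carrier} → (∀ t → f t ≈ g t) → ∀ T → map f T ≋ map g T
    map-≈ f≈g []      = []
    map-≈ f≈g (t ∷ T) = f≈g t ∷ map-≈ f≈g T

    sweep⁺-act : ∀ e T rest → actL (sweep⁺ (length T)) (e ∷ T ++ rest) ≡ T ++ foldl _^_ e T ∷ rest
    sweep⁺-act e []      rest = ≡.refl
    sweep⁺-act e (t ∷ T) rest = ≡.trans (actL-shift (t ∷ []) (sweep⁺ (length T)) (e ^ t ∷ T ++ rest))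
                                        (cong (t ∷_) (sweep⁺-act (e ^ t) T rest))

    sweep⁻-act : ∀ e T rest → actL (sweep⁻ (length T)) (e ∷ T ++ rest) ≡ map (λ t → e ∙ t ∙ e ⁻¹) T ++ e ∷ rest
    sweep⁻-act e []      rest = ≡.refl
    sweep⁻-act e (t ∷ T) rest = ≡.trans (actL-shift (e ∙ t ∙ e ⁻¹ ∷ []) (sweep⁻ (length T)) (e ∷ T ++ rest))
                                        (cong (e ∙ t ∙ e ⁻¹ ∷_) (sweep⁻-act e T rest))

    sweep⁺-transparent : ∀ z {T} rest → ∏ T ≈ ε → actL (sweep⁺ (length T)) (z ∷ T ++ rest) ≋ T ++ z ∷ rest
    sweep⁺-transparent z {T} rest ∏T≈ε =
      ≋-trans (≋-reflexive (sweep⁺-act z T rest)) (++⁺ˡ T (trans (foldl-^ z T) (^-≈ε ∏T≈ε) ∷ ≋-refl))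

    passBlock-act : ∀ {T} Z rest → ∏ T ≈ ε → actL (passBlock (length T) (length Z)) (T ++ Z ++ rest) ≋ Z ++ T ++ rest
    passBlock-act         []      rest ∏T≈ε = ≋-refl
    passBlock-act {T = T} (z ∷ Z) rest ∏T≈ε = begin
      actL (invert (sweep⁺ n) ++ shift 1 (passBlock n k)) (T ++ z ∷ Z ++ rest)
        ≡⟨ actL-++ (invert (sweep⁺ n)) _ _ ⟩
      actL (shift 1 (passBlock n k)) (actL (invert (sweep⁺ n)) (T ++ z ∷ Z ++ rest))
        ≈⟨ actL-cong (shift 1 (passBlock n k)) (actL-invert (sweep⁺ n) (sweep⁺-transparent z (Z ++ rest) ∏T≈ε)) ⟩
      actL (shift 1 (passBlock n k)) (z ∷ T ++ Z ++ rest)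
        ≡⟨ actL-shift (z ∷ []) (passBlock n k) _ ⟩
      z ∷ actL (passBlock n k) (T ++ Z ++ rest)
        ≈⟨ refl ∷ passBlock-act Z rest ∏T≈ε ⟩
      z ∷ Z ++ T ++ rest
        ∎
      where
      n = length T
      k = length Z

    transported-act : ∀ w {T T′} Z x rest → ∏ T ≈ ε → ∏ T′ ≈ ε → length T′ ≡ length T →
      (∀ r → actL w (T ++ x ∷ r) ≋ T′ ++ x ∷ r) →
      actL (transported (length T) (length Z) w) (T ++ Z ++ x ∷ rest) ≋ T′ ++ Z ++ x ∷ rest
    transported-act w {T} {T′} Z x rest ∏T≈ε ∏T′≈ε |T′|≡|T| w-act = begin
      actL (pass ++ shift k w ++ invert pass) (T ++ Z ++ x ∷ rest)
        ≡⟨ actL-++ pass _ _ ⟩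
      actL (shift k w ++ invert pass) (actL pass (T ++ Z ++ x ∷ rest))
        ≡⟨ actL-++ (shift k w) (invert pass) _ ⟩
      actL (invert pass) (actL (shift k w) (actL pass (T ++ Z ++ x ∷ rest)))
        ≈⟨ actL-cong (invert pass) (actL-cong (shift k w) (passBlock-act Z (x ∷ rest) ∏T≈ε)) ⟩
      actL (invert pass) (actL (shift k w) (Z ++ T ++ x ∷ rest))
        ≡⟨ cong (actL (invert pass)) (actL-shift Z w (T ++ x ∷ rest)) ⟩
      actL (invert pass) (Z ++ actL w (T ++ x ∷ rest))
        ≈⟨ actL-cong (invert pass) (++⁺ˡ Z (w-act rest)) ⟩
      actL (invert pass) (Z ++ T′ ++ x ∷ rest)
        ≈⟨ actL-invert pass pass-T′ ⟩
      T′ ++ Z ++ x ∷ rest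
        ∎
      where
      k = length Z
      pass = passBlock (length T) k
      pass-T′ : actL pass (T′ ++ Z ++ x ∷ rest) ≋ Z ++ T′ ++ x ∷ rest
      pass-T′ = ≡.subst (λ n → actL (passBlock n k) (T′ ++ Z ++ x ∷ rest) ≋ Z ++ T′ ++ x ∷ rest)
                        |T′|≡|T| (passBlock-act Z (x ∷ rest) ∏T′≈ε)

    conjugateBlock-act : ∀ T x rest → ∏ T ≈ ε → actL (conjugateBlock (length T)) (T ++ x ∷ rest) ≋ map (_^ x) T ++ x ∷ rest
    conjugateBlock-act T x rest ∏T≈ε = begin
      actL (invert (sweep⁻ n) ++ sweep⁺ n) (T ++ x ∷ rest)
        ≡⟨ actL-++ (invert (sweep⁻ n)) (sweep⁺ n) _ ⟩
      actL (sweep⁺ n) (actL (invert (sweep⁻ n)) (T ++ x ∷ rest))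
        ≈⟨ actL-cong (sweep⁺ n) (actL-invert (sweep⁻ n) unconjugate) ⟩
      actL (sweep⁺ n) (x ∷ T^x ++ rest)
        ≡⟨ cong (λ n → actL (sweep⁺ n) (x ∷ T^x ++ rest)) (≡.sym (length-map (_^ x) T)) ⟩
      actL (sweep⁺ (length T^x)) (x ∷ T^x ++ rest)
        ≈⟨ sweep⁺-transparent x rest (∏-map-^-≈ε x {T} ∏T≈ε) ⟩
      T^x ++ x ∷ rest
        ∎
      where
      open Data.List.Properties using (map-id)
      n = length T
      T^x = map (_^ x) T
      unconjugate : actL (sweep⁻ n) (x ∷ T^x ++ rest) ≋ T ++ x ∷ rest
      unconjugate = begin
        actL (sweep⁻ n) (x ∷ T^x ++ rest)
          ≡⟨ cong (λ n → actL (sweep⁻ n) (x ∷ T^x ++ rest)) (≡.sym (length-map (_^ x) T)) ⟩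
        actL (sweep⁻ (length T^x)) (x ∷ T^x ++ rest)
          ≡⟨ sweep⁻-act x T^x rest ⟩
        map (λ t → x ∙ t ∙ x ⁻¹) T^x ++ x ∷ rest
          ≡⟨ cong (_++ x ∷ rest) (≡.sym (map-∘ T)) ⟩
        map (λ t → x ∙ t ^ x ∙ x ⁻¹) T ++ x ∷ rest
          ≈⟨ ++⁺ (map-≈ (λ t → trans (∙-∙⁻¹≈^⁻¹ x (t ^ x)) (^-^⁻¹ t x)) T) ≋-refl ⟩
        map (λ t → t) T ++ x ∷ rest
          ≡⟨ cong (_++ x ∷ rest) (map-id T) ⟩
        T ++ x ∷ rest
          ∎

    conjugateBlockAcross : ∀ {T} Z x rest → ∏ T ≈ ε →
      actL (transported (length T) (length Z) (conjugateBlock (length T))) (T ++ Z ++ x ∷ rest) ≋ map (_^ x) T ++ Z ++ x ∷ rest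
    conjugateBlockAcross {T} Z x rest ∏T≈ε =
      transported-act (conjugateBlock (length T)) Z x rest ∏T≈ε (∏-map-^-≈ε x {T} ∏T≈ε) (length-map (_^ x) T)
                      (λ r → conjugateBlock-act T x r ∏T≈ε)

    pairLeft-act : ∀ Z p₁ p₂ rest →
      actL (pairLeft (length Z)) (Z ++ p₁ ∷ p₂ ∷ rest) ≡ p₁ ∷ p₂ ∷ map (λ z → (z ^ p₁) ^ p₂) Z ++ rest
    pairLeft-act []      p₁ p₂ rest = ≡.refl
    pairLeft-act (z ∷ Z) p₁ p₂ rest =
      ≡.trans (actL-++ (shift 1 (pairLeft (length Z))) ((0 , true) ∷ (1 , true) ∷ []) (z ∷ Z ++ p₁ ∷ p₂ ∷ rest))
              (cong (actL ((0 , true) ∷ (1 , true) ∷ []))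
                    (≡.trans (actL-shift (z ∷ []) (pairLeft (length Z)) (Z ++ p₁ ∷ p₂ ∷ rest))
                             (cong (z ∷_) (pairLeft-act Z p₁ p₂ rest))))

    conjugatePair-act : ∀ t Z p₁ p₂ rest → (t ^ p₁) ^ p₂ ≈ t → (p₁ ∙ p₂) ^ t ≈ p₁ ∙ p₂ →
      actL (conjugatePair (length Z)) (t ∷ Z ++ p₁ ∷ p₂ ∷ rest) ≋ t ∷ Z ++ p₁ ^ t ∷ p₂ ^ t ∷ rest
    conjugatePair-act t Z p₁ p₂ rest t-fixed pair-fixed = begin
      actL (toFront ++ pairLoop ++ invert toFront) (t ∷ Z ++ p₁ ∷ p₂ ∷ rest)
        ≡⟨ actL-++ toFront _ _ ⟩
      actL (pairLoop ++ invert toFront) (actL toFront (t ∷ Z ++ p₁ ∷ p₂ ∷ rest))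
        ≡⟨ actL-++ pairLoop (invert toFront) (actL toFront (t ∷ Z ++ p₁ ∷ p₂ ∷ rest)) ⟩
      actL (invert toFront) (actL pairLoop (actL toFront (t ∷ Z ++ p₁ ∷ p₂ ∷ rest)))
        ≡⟨ cong (λ v → actL (invert toFront) (actL pairLoop v)) (toFront-act p₁ p₂) ⟩
      actL (invert toFront) (t′ ∷ p₁ ^ t′ ∷ p₂ ^ t′ ∷ map (λ z → (z ^ p₁) ^ p₂) Z ++ rest)
        ≈⟨ actL-cong (invert toFront)
             (t-fixed ∷ ^-cong refl t-fixed ∷ ^-cong refl t-fixed ∷ ++⁺ (map-≈ same-conjugation Z) ≋-refl) ⟩
      actL (invert toFront) (t ∷ p₁ ^ t ∷ p₂ ^ t ∷ map (λ z → (z ^ (p₁ ^ t)) ^ (p₂ ^ t)) Z ++ rest)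
        ≈⟨ actL-invert toFront (≋-reflexive (toFront-act (p₁ ^ t) (p₂ ^ t))) ⟩
      t ∷ Z ++ p₁ ^ t ∷ p₂ ^ t ∷ rest
        ∎
      where
      toFront = shift 1 (pairLeft (length Z))
      t′ = (t ^ p₁) ^ p₂
      toFront-act : ∀ q₁ q₂ →
        actL toFront (t ∷ Z ++ q₁ ∷ q₂ ∷ rest) ≡ t ∷ q₁ ∷ q₂ ∷ map (λ z → (z ^ q₁) ^ q₂) Z ++ rest
      toFront-act q₁ q₂ = ≡.trans (actL-shift (t ∷ []) (pairLeft (length Z)) _) (cong (t ∷_) (pairLeft-act Z q₁ q₂ rest))
      same-conjugation : ∀ z → (z ^ p₁) ^ p₂ ≈ (z ^ (p₁ ^ t)) ^ (p₂ ^ t)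
      same-conjugation z =
        trans (sym (^-∙ z p₁ p₂))
       (trans (^-cong refl (sym pair-fixed))
       (trans (^-cong refl (^-distrib-∙ p₁ p₂ t))
              (^-∙ z (p₁ ^ t) (p₂ ^ t))))

  -- Following strands

  -- rel strands carry the relators (trivial G₂-coordinate), mark strands carry the X_i.
  data Strand : Set where
    rel mark : Strand

  swapAt : ℕ → List Strand → List Strand
  swapAt zero    (s ∷ t ∷ ss) = t ∷ s ∷ ss
  swapAt (suc p) (s ∷ ss)     = s ∷ swapAt p ss
  swapAt _       ss           = ss

  -- The letter as seen by the marked strands alone.
  induced : ℕ × Bool → List Strand → Word
  induced (zero  , b) (mark ∷ mark ∷ ss) = (0 , b) ∷ []
  induced (suc p , b) (rel ∷ ss)         = induced (p , b) ss
  induced (suc p , b) (mark ∷ ss)        = shift 1 (induced (p , b) ss)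
  induced _           _                  = []

  inducedWord : Word → List Strand → Word
  inducedWord []      ss = []
  inducedWord (x ∷ w) ss = induced x ss ++ inducedWord w (swapAt (proj₁ x) ss)

  strandsAfter : Word → List Strand → List Strand
  strandsAfter []      ss = ss
  strandsAfter (x ∷ w) ss = strandsAfter w (swapAt (proj₁ x) ss)

  module Tracking {c ℓ p} (K : Group c ℓ) (S N : Group.Carrier K → Set p)
    (S-∙ : ∀ {x y} → S x → S y → S (Group._∙_ K x y))
    (S-⁻¹ : ∀ {x} → S x → S (Group._⁻¹ K x))
    (S-resp : ∀ {x y} → Group._≈_ K x y → S x → S y)
    (N⊆S : ∀ {x} → N x → S x)
    (N-∙ : ∀ {x y} → N x → N y → N (Group._∙_ K x y))
    (N-⁻¹ : ∀ {x} → N x → N (Group._⁻¹ K x))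
    (N-resp : ∀ {x y} → Group._≈_ K x y → N x → N y)
    (N-^ : ∀ {x y} → N x → S y → N (GroupDefs._^_ K x y))
    where
    open Group K
    open GroupDefs K using (_^_)
    open GroupProperties K using (⁻¹-involutive; \\-leftDividesˡ; \\-leftDividesʳ)
    open MonoidSolver monoid using (solve; _⊜_; _⊕_)
    open Conjugation K
    open OnLists K
    open import Data.List.Relation.Unary.All using (All; []; _∷_)
    open import Relation.Binary.Reasoning.Setoid setoid

    S-^ : ∀ {a b} → S a → S b → S (a ^ b)
    S-^ sa sb = S-∙ (S-∙ (S-⁻¹ sb) sa) sb

    -- Tracked ss u a: rel entries of u lie in N, and the marked entries of u are the entries of a,
    -- the tuple moved by the induced braid, each conjugated by an element of N.
    data Tracked : List Strand → List Carrier → List Carrier → Set (c ⊔ ℓ ⊔ p) where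
      []       : Tracked [] [] []
      relator  : ∀ {ss u a r} → N r → Tracked ss u a → Tracked (rel ∷ ss) (r ∷ u) a
      conj     : ∀ {ss u a f a₀} y → S a₀ → N y → f ≈ a₀ ^ y →
                 Tracked ss u a → Tracked (mark ∷ ss) (f ∷ u) (a₀ ∷ a)

    tracked-resp : ∀ {ss u v a} → Tracked ss u a → u ≋ v → Tracked ss v a
    tracked-resp []                  []       = []
    tracked-resp (relator nr tr)     (e ∷ es) = relator (N-resp e nr) (tracked-resp tr es)
    tracked-resp (conj y sa ny f≈ tr) (e ∷ es) = conj y sa ny (trans (sym e) f≈) (tracked-resp tr es)

    S-tracked : ∀ {f a₀ y} → S a₀ → N y → f ≈ a₀ ^ y → S f
    S-tracked sa ny f≈ = S-resp (sym f≈) (S-^ sa (N⊆S ny))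

    -- The new conjugator b⁻¹ y bᶻ equals (y z⁻¹)ᵇ z, which lies in N because N is normal in S.
    σL-conjugator : ∀ y b z → N y → N z → S b → N (b ⁻¹ ∙ (y ∙ b ^ z))
    σL-conjugator y b z ny nz sb = N-resp regroup (N-∙ (N-^ (N-∙ ny (N-⁻¹ nz)) sb) nz)
      where
      regroup : (y ∙ z ⁻¹) ^ b ∙ z ≈ b ⁻¹ ∙ (y ∙ b ^ z)
      regroup = solve 5 (λ y z′ b b′ z → ((b′ ⊕ (y ⊕ z′)) ⊕ b) ⊕ z ⊜ b′ ⊕ (y ⊕ ((z′ ⊕ b) ⊕ z)))
                        refl y (z ⁻¹) b (b ⁻¹) z

    σL⁻-conjugator : ∀ a y z → N y → N z → S a → N (a ∙ (z ∙ (a ^ y) ⁻¹))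
    σL⁻-conjugator a y z ny nz sa = N-resp regroup (N-∙ (N-^ (N-∙ nz (N-⁻¹ ny)) (S-⁻¹ sa)) ny)
      where
      regroup : (z ∙ y ⁻¹) ^ (a ⁻¹) ∙ y ≈ a ∙ (z ∙ (a ^ y) ⁻¹)
      regroup = begin
        (z ∙ y ⁻¹) ^ (a ⁻¹) ∙ y              ≈⟨ ∙-congʳ (∙-congʳ (∙-congʳ (⁻¹-involutive a))) ⟩
        a ∙ (z ∙ y ⁻¹) ∙ a ⁻¹ ∙ y            ≈⟨ solve 5 (λ a z y′ a′ y → ((a ⊕ (z ⊕ y′)) ⊕ a′) ⊕ y
                                                                  ⊜ a ⊕ (z ⊕ ((y′ ⊕ a′) ⊕ y)))
                                                      refl a z (y ⁻¹) (a ⁻¹) y ⟩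
        a ∙ (z ∙ (y ⁻¹ ∙ a ⁻¹ ∙ y))          ≈⟨ ∙-congˡ (∙-congˡ (^-distrib-⁻¹ a y)) ⟩
        a ∙ (z ∙ (a ^ y) ⁻¹)                 ∎

    σL-tracked : ∀ p {ss u a} → Tracked ss u a → Tracked (swapAt p ss) (σL p u) (actL (induced (p , true) ss) a)
    σL-tracked zero []                               = []
    σL-tracked zero (relator nr [])                  = relator nr []
    σL-tracked zero (conj y sa ny f≈ [])             = conj y sa ny f≈ []
    σL-tracked zero (relator nr (relator ns tr))     = relator ns (relator (N-^ nr (N⊆S ns)) tr)
    σL-tracked zero (relator nr (conj z sb nz g≈ tr)) = conj z sb nz g≈ (relator (N-^ nr (S-tracked sb nz g≈)) tr)
    σL-tracked zero (conj {a₀ = a} y sa ny f≈ (relator {r = r} nr tr)) =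
      relator nr (conj (y ∙ r) sa (N-∙ ny nr) (trans (^-cong f≈ refl) (sym (^-∙ a y r))) tr)
    σL-tracked zero (conj {f = f} {a₀ = a} y sa ny f≈ (conj {f = g} {a₀ = b} z sb nz g≈ tr)) =
      conj z sb nz g≈ (conj (b ⁻¹ ∙ (y ∙ b ^ z)) (S-^ sa sb) (σL-conjugator y b z ny nz sb) f^g≈ tr)
      where
      f^g≈ : f ^ g ≈ (a ^ b) ^ (b ⁻¹ ∙ (y ∙ b ^ z))
      f^g≈ = begin
        f ^ g                           ≈⟨ ^-cong f≈ g≈ ⟩
        (a ^ y) ^ (b ^ z)               ≈⟨ ^-∙ a y (b ^ z) ⟨
        a ^ (y ∙ b ^ z)                 ≈⟨ ^-cong refl (\\-leftDividesˡ b _) ⟨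
        a ^ (b ∙ (b ⁻¹ ∙ (y ∙ b ^ z)))  ≈⟨ ^-∙ a b _ ⟩
        (a ^ b) ^ (b ⁻¹ ∙ (y ∙ b ^ z))  ∎
    σL-tracked (suc q) []              = []
    σL-tracked (suc q) (relator nr tr) = relator nr (σL-tracked q tr)
    σL-tracked (suc q) {mark ∷ ss} {a = a₀ ∷ a} (conj y sa ny f≈ tr)
      rewrite actL-shift (a₀ ∷ []) (induced (q , true) ss) a = conj y sa ny f≈ (σL-tracked q tr)

    σL⁻-tracked : ∀ p {ss u a} → Tracked ss u a → Tracked (swapAt p ss) (σL⁻ p u) (actL (induced (p , false) ss) a)
    σL⁻-tracked zero []                               = []
    σL⁻-tracked zero (relator nr [])                  = relator nr []
    σL⁻-tracked zero (conj y sa ny f≈ [])             = conj y sa ny f≈ []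
    σL⁻-tracked zero (relator {r = r} nr (relator {r = s} ns tr)) =
      relator (N-resp (sym (∙-∙⁻¹≈^⁻¹ r s)) (N-^ ns (S-⁻¹ (N⊆S nr)))) (relator nr tr)
    σL⁻-tracked zero (relator {r = r} nr (conj {f = g} {a₀ = b} z sb nz g≈ tr)) =
      conj (z ∙ r ⁻¹) sb (N-∙ nz (N-⁻¹ nr))
           (trans (∙-∙⁻¹≈^⁻¹ r g) (trans (^-cong g≈ refl) (sym (^-∙ b z (r ⁻¹))))) (relator nr tr)
    σL⁻-tracked zero (conj {f = f} y sa ny f≈ (relator {r = r} nr tr)) =
      relator (N-resp (sym (∙-∙⁻¹≈^⁻¹ f r)) (N-^ nr (S-⁻¹ (S-tracked sa ny f≈)))) (conj y sa ny f≈ tr)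
    σL⁻-tracked zero (conj {f = f} {a₀ = a} y sa ny f≈ (conj {f = g} {a₀ = b} z sb nz g≈ tr)) =
      conj y′ (S-∙ (S-∙ sa sb) (S-⁻¹ sa)) (σL⁻-conjugator a y z ny nz sa) f∙g∙f⁻¹≈ (conj y sa ny f≈ tr)
      where
      y′ = a ∙ (z ∙ (a ^ y) ⁻¹)
      f∙g∙f⁻¹≈ : f ∙ g ∙ f ⁻¹ ≈ (a ∙ b ∙ a ⁻¹) ^ y′
      f∙g∙f⁻¹≈ = begin
        f ∙ g ∙ f ⁻¹                ≈⟨ ∙-∙⁻¹≈^⁻¹ f g ⟩
        g ^ (f ⁻¹)                  ≈⟨ ^-cong g≈ (⁻¹-cong f≈) ⟩
        (b ^ z) ^ ((a ^ y) ⁻¹)      ≈⟨ ^-∙ b z _ ⟨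
        b ^ (z ∙ (a ^ y) ⁻¹)        ≈⟨ ^-cong refl (\\-leftDividesʳ a _) ⟨
        b ^ (a ⁻¹ ∙ y′)             ≈⟨ ^-∙ b (a ⁻¹) y′ ⟩
        (b ^ (a ⁻¹)) ^ y′           ≈⟨ ^-cong (∙-∙⁻¹≈^⁻¹ a b) refl ⟨
        (a ∙ b ∙ a ⁻¹) ^ y′         ∎
    σL⁻-tracked (suc q) []              = []
    σL⁻-tracked (suc q) (relator nr tr) = relator nr (σL⁻-tracked q tr)
    σL⁻-tracked (suc q) {mark ∷ ss} {a = a₀ ∷ a} (conj y sa ny f≈ tr)
      rewrite actL-shift (a₀ ∷ []) (induced (q , false) ss) a = conj y sa ny f≈ (σL⁻-tracked q tr)

    actL-tracked : ∀ w {ss u a} → Tracked ss u a → Tracked (strandsAfter w ss) (actL w u) (actL (inducedWord w ss) a)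
    actL-tracked []                {ss} {u} {a} tr = tr
    actL-tracked ((p , true) ∷ w)  {ss} {u} {a} tr
      rewrite actL-++ (induced (p , true) ss) (inducedWord w (swapAt p ss)) a = actL-tracked w (σL-tracked p tr)
    actL-tracked ((p , false) ∷ w) {ss} {u} {a} tr
      rewrite actL-++ (induced (p , false) ss) (inducedWord w (swapAt p ss)) a = actL-tracked w (σL⁻-tracked p tr)

    initially-tracked : N ε → ∀ {Rs Vs} → All N Rs → All S Vs →
      Tracked (replicate (length Rs) rel ++ replicate (length Vs) mark) (Rs ++ Vs) Vs
    initially-tracked nε []         []         = []
    initially-tracked nε []         (sv ∷ svs) = conj ε sv nε (sym (^-identityʳ _)) (initially-tracked nε [] svs)
    initially-tracked nε (nr ∷ nrs) svs        = relator nr (initially-tracked nε nrs svs)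

  -- The two implications

  module Forward {c₁ ℓ₁ c₂ ℓ₂} (G₁ : Group c₁ ℓ₁) (G₂ : Group c₂ ℓ₂) {n m}
    (R : Vec (Group.Carrier G₁) n) (W : Vec (Group.Carrier G₁) m)
    (∏R≈ε : Group._≈_ G₁ (GroupDefs.prod G₁ R) (Group.ε G₁))
    (S : List (Group.Carrier G₁ × Group.Carrier G₂))
    (W∈S : ∀ j → ∃[ x ] ((lookup W j , x) ∈ S))
    (x₁ x₂ : Group.Carrier G₂)
    where
    private
      module ₁ = Group G₁
      module ₂ = Group G₂
      module C₁ = Conjugation G₁
      module C₂ = Conjugation G₂
      module M₁ = Moves G₁
    open Group (G₁⊕G₂ G₁ G₂)
    open GroupDefs (G₁⊕G₂ G₁ G₂) using (_^_)
    open GroupDefs G₁ using (gen; unit; inv; mul; resp; NormalClosure) renaming (_^_ to _^₁_)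
    open Conjugation (G₁⊕G₂ G₁ G₂)
    open OnLists (G₁⊕G₂ G₁ G₂)
    open Moves (G₁⊕G₂ G₁ G₂)
    open Closures G₁ R W
    open import Relation.Binary.Reasoning.Setoid ≋-setoid

    RL : List ₁.Carrier
    RL = V.toList R

    ι : ₁.Carrier → Carrier
    ι r = (r , ₂.ε)

    block : ₁.Carrier → List Carrier
    block u = map (λ r → ι (r ^₁ u)) RL

    pair : ₁.Carrier → List Carrier
    pair H = (H ₁.⁻¹ , x₁) ∷ (H , x₂) ∷ []

    Q : ₁.Carrier → List Carrier
    Q H = block ₁.ε ++ S ++ pair H

    Q-cong : ∀ {H H′} → H ₁.≈ H′ → Q H ≋ Q H′
    Q-cong H≈H′ = ++⁺ˡ (block ₁.ε) (++⁺ˡ S ((₁.⁻¹-cong H≈H′ , ₂.refl) ∷ (H≈H′ , ₂.refl) ∷ []))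

    Q-unfold : ∀ H → map ι RL ++ S ++ pair H ≋ Q H
    Q-unfold H = ++⁺ (map-≈ (λ r → ₁.sym (C₁.^-identityʳ r) , ₂.refl) RL) ≋-refl

    block-cong : ∀ {u u′} → u ₁.≈ u′ → block u ≋ block u′
    block-cong u≈u′ = map-≈ (λ r → C₁.^-cong ₁.refl u≈u′ , ₂.refl) RL

    ∏-block : ∀ u → ∏ (block u) ≈ ε
    ∏-block u = trans (∏-ι RL) (₁.trans (C₁.^-cong ∏RL≈ε ₁.refl) (C₁.ε-^ u) , ₂.refl)
      where
      ∏RL≈ε : M₁.∏ RL ₁.≈ ₁.ε
      ∏RL≈ε = ≡.subst (₁._≈ ₁.ε) (M₁.prod≡∏ R) ∏R≈ε
      ∏-ι : ∀ T → ∏ (map (λ r → ι (r ^₁ u)) T) ≈ (M₁.∏ T ^₁ u , ₂.ε)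
      ∏-ι []      = ₁.sym (C₁.ε-^ u) , ₂.refl
      ∏-ι (t ∷ T) = ₁.trans (₁.∙-congˡ (proj₁ (∏-ι T))) (₁.sym (C₁.^-distrib-∙ t (M₁.∏ T) u)) ,
                    ₂.trans (₂.∙-congˡ (proj₂ (∏-ι T))) (₂.identityˡ ₂.ε)

    BlockConjugator : ₁.Carrier → Set (c₁ ⊔ ℓ₁ ⊔ c₂ ⊔ ℓ₂)
    BlockConjugator v = Σ Word λ ω → ∀ u rest → actL ω (block u ++ S ++ rest) ≋ block (u ₁.∙ v) ++ S ++ rest

    blockConjugator : ∀ {v} → WSpan v → BlockConjugator v
    blockConjugator (gen {g} (l , Wₗ≈g)) with W∈S l
    ... | x , Wₗx∈S with ∈-∃++ Wₗx∈S
    ... | S₁ , S₂ , S≡ = ω , conjugate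
      where
      w = (lookup W l , x)
      ω = transported (length RL) (length S₁) (conjugateBlock (length RL))
      S++≡ : ∀ rest → S ++ rest ≡ S₁ ++ w ∷ S₂ ++ rest
      S++≡ rest = ≡.trans (cong (_++ rest) S≡) (++-assoc S₁ (w ∷ S₂) rest)
      conjugate : ∀ u rest → actL ω (block u ++ S ++ rest) ≋ block (u ₁.∙ g) ++ S ++ rest
      conjugate u rest = begin
        actL ω (block u ++ S ++ rest)
          ≡⟨ cong (λ L → actL ω (block u ++ L)) (S++≡ rest) ⟩
        actL ω (block u ++ S₁ ++ w ∷ S₂ ++ rest)
          ≈⟨ ≡.subst (λ k → actL (transported k (length S₁) (conjugateBlock k)) (block u ++ S₁ ++ w ∷ S₂ ++ rest)
                               ≋ map (_^ w) (block u) ++ S₁ ++ w ∷ S₂ ++ rest)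
                     (length-map _ RL) (conjugateBlockAcross {block u} S₁ w (S₂ ++ rest) (∏-block u)) ⟩
        map (_^ w) (block u) ++ S₁ ++ w ∷ S₂ ++ rest
          ≡⟨ cong (_++ S₁ ++ w ∷ S₂ ++ rest) (≡.sym (map-∘ RL)) ⟩
        map (λ r → ι (r ^₁ u) ^ w) RL ++ S₁ ++ w ∷ S₂ ++ rest
          ≈⟨ ++⁺ (map-≈ (λ r → ₁.trans (₁.sym (C₁.^-∙ r u _)) (C₁.^-cong ₁.refl (₁.∙-congˡ Wₗ≈g)) , C₂.ε-^ x) RL)
                 ≋-refl ⟩
        block (u ₁.∙ g) ++ S₁ ++ w ∷ S₂ ++ rest
          ≡⟨ cong (block (u ₁.∙ g) ++_) (≡.sym (S++≡ rest)) ⟩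
        block (u ₁.∙ g) ++ S ++ rest
          ∎
    blockConjugator unit = [] , λ u rest → ++⁺ (block-cong (₁.sym (₁.identityʳ u))) ≋-refl
    blockConjugator (inv {x} sx) with blockConjugator sx
    ... | ω , ω-act = invert ω , λ u rest →
      actL-invert ω (≋-trans (ω-act (u ₁.∙ x ₁.⁻¹) rest) (++⁺ (block-cong (//-rightDividesˡ x u)) ≋-refl))
      where open GroupProperties G₁ using (//-rightDividesˡ)
    blockConjugator (mul {x} {y} sx sy) with blockConjugator sx | blockConjugator sy
    ... | ω , ω-act | ω′ , ω′-act = ω ++ ω′ , λ u rest → begin
      actL (ω ++ ω′) (block u ++ S ++ rest)      ≡⟨ actL-++ ω ω′ _ ⟩
      actL ω′ (actL ω (block u ++ S ++ rest))    ≈⟨ actL-cong ω′ (ω-act u rest) ⟩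
      actL ω′ (block (u ₁.∙ x) ++ S ++ rest)     ≈⟨ ω′-act (u ₁.∙ x) rest ⟩
      block (u ₁.∙ x ₁.∙ y) ++ S ++ rest         ≈⟨ ++⁺ (block-cong (₁.assoc u x y)) ≋-refl ⟩
      block (u ₁.∙ (x ₁.∙ y)) ++ S ++ rest       ∎
    blockConjugator (resp x≈y sx) with blockConjugator sx
    ... | ω , ω-act = ω , λ u rest → ≋-trans (ω-act u rest) (++⁺ (block-cong (₁.∙-congˡ x≈y)) ≋-refl)

    Achieves : ₁.Carrier → Set (c₁ ⊔ ℓ₁ ⊔ c₂ ⊔ ℓ₂)
    Achieves y = ∀ H → Q H ∼ Q (H ^₁ y)

    achieves-generator : ∀ i {v} → WSpan v → Achieves (lookup R i ^₁ v)
    achieves-generator i {v} wv H with blockConjugator wv | ∈-∃++ (∈-toList⁺ (∈-lookup i R))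
    ... | ω , ω-act | R₁ , R₂ , RL≡ = ∼-respʳ (Q-cong (C₁.^-cong ₁.refl (C₁.^-cong ₁.refl (₁.identityˡ v))))
                                                (ω ++ shift (length B₁) (conjugatePair (length Z)) ++ invert ω , moved)
      where
      f : ₁.Carrier → Carrier
      f r = ι (r ^₁ (₁.ε ₁.∙ v))
      t = lookup R i ^₁ (₁.ε ₁.∙ v)
      B₁ = map f R₁
      Z = map f R₂ ++ S
      split : ∀ H → block (₁.ε ₁.∙ v) ++ S ++ pair H ≋ B₁ ++ ι t ∷ Z ++ pair H
      split H = begin
        map f RL ++ S ++ pair H                      ≡⟨ cong (λ L → map f L ++ S ++ pair H) RL≡ ⟩
        map f (R₁ ++ lookup R i ∷ R₂) ++ S ++ pair H  ≡⟨ cong (_++ S ++ pair H) (map-++ f R₁ _) ⟩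
        (B₁ ++ ι t ∷ map f R₂) ++ S ++ pair H         ≡⟨ ++-assoc B₁ _ _ ⟩
        B₁ ++ ι t ∷ map f R₂ ++ S ++ pair H           ≡⟨ cong (λ L → B₁ ++ ι t ∷ L) (≡.sym (++-assoc (map f R₂) S _)) ⟩
        B₁ ++ ι t ∷ Z ++ pair H                       ∎
      t-fixed : (ι t ^ (H ₁.⁻¹ , x₁)) ^ (H , x₂) ≈ ι t
      t-fixed = C₁.^⁻¹-^ t H , ₂.trans (C₂.^-cong (C₂.ε-^ x₁) ₂.refl) (C₂.ε-^ x₂)
      pair-fixed : ((H ₁.⁻¹ , x₁) ∙ (H , x₂)) ^ ι t ≈ (H ₁.⁻¹ , x₁) ∙ (H , x₂)
      pair-fixed = ₁.trans (C₁.^-cong (₁.inverseˡ H) ₁.refl) (₁.trans (C₁.ε-^ t) (₁.sym (₁.inverseˡ H))) ,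
                   C₂.^-identityʳ _
      pair-conjugated : (H ₁.⁻¹ , x₁) ^ ι t ∷ (H , x₂) ^ ι t ∷ [] ≋ pair (H ^₁ t)
      pair-conjugated = (C₁.^-distrib-⁻¹ H t , C₂.^-identityʳ x₁) ∷ (₁.refl , C₂.^-identityʳ x₂) ∷ []
      cp = shift (length B₁) (conjugatePair (length Z))
      moved : actL (ω ++ cp ++ invert ω) (Q H) ≋ Q (H ^₁ t)
      moved = begin
        actL (ω ++ cp ++ invert ω) (Q H)
          ≡⟨ actL-++ ω _ (Q H) ⟩
        actL (cp ++ invert ω) (actL ω (Q H))
          ≡⟨ actL-++ cp (invert ω) _ ⟩
        actL (invert ω) (actL cp (actL ω (Q H)))
          ≈⟨ actL-cong (invert ω) (actL-cong cp (ω-act ₁.ε (pair H))) ⟩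
        actL (invert ω) (actL cp (block (₁.ε ₁.∙ v) ++ S ++ pair H))
          ≈⟨ actL-cong (invert ω) (actL-cong cp (split H)) ⟩
        actL (invert ω) (actL cp (B₁ ++ ι t ∷ Z ++ pair H))
          ≡⟨ cong (actL (invert ω)) (actL-shift B₁ (conjugatePair (length Z)) _) ⟩
        actL (invert ω) (B₁ ++ actL (conjugatePair (length Z)) (ι t ∷ Z ++ pair H))
          ≈⟨ actL-cong (invert ω) (++⁺ˡ B₁ (≋-trans (conjugatePair-act (ι t) Z _ _ [] t-fixed pair-fixed)
                                                     (refl ∷ ++⁺ˡ Z pair-conjugated))) ⟩
        actL (invert ω) (B₁ ++ ι t ∷ Z ++ pair (H ^₁ t))
          ≈⟨ actL-cong (invert ω) (≋-sym (split (H ^₁ t))) ⟩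
        actL (invert ω) (block (₁.ε ₁.∙ v) ++ S ++ pair (H ^₁ t))
          ≈⟨ actL-invert ω (ω-act ₁.ε (pair (H ^₁ t))) ⟩
        Q (H ^₁ t)
          ∎

    achieves : ∀ {y} → WConjugateClosure y → Achieves y
    achieves (gen (i , v , wv , y≈)) H = ∼-respʳ (Q-cong (C₁.^-cong ₁.refl (₁.sym y≈))) (achieves-generator i wv H)
    achieves unit                    H = ∼-respʳ (Q-cong (₁.sym (C₁.^-identityʳ H))) ∼-refl
    achieves (inv {x} nx)            H = ∼-sym (∼-respʳ (Q-cong (C₁.^⁻¹-^ H x)) (achieves nx (H ^₁ (x ₁.⁻¹))))
    achieves (mul {x} {y} nx ny)     H =
      ∼-trans (achieves nx H) (∼-respʳ (Q-cong (₁.sym (C₁.^-∙ H x y))) (achieves ny (H ^₁ x)))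
    achieves (resp x≈y nx)           H = ∼-respʳ (Q-cong (C₁.^-cong ₁.refl x≈y)) (achieves nx H)

    forward : ∀ {Y H H₁} → NormalClosure R W Y → H ^₁ Y ₁.≈ H₁ → Q H ∼ Q H₁
    forward {H = H} nY H^Y≈H₁ = ∼-respʳ (Q-cong H^Y≈H₁) (achieves (NormalClosure⊆WConjugateClosure nY) H)

  module Backward {c₁ ℓ₁ c₂ ℓ₂} (G₁ : Group c₁ ℓ₁) (G₂ : Group c₂ ℓ₂) {n m}
    (R : Vec (Group.Carrier G₁) n) (W : Vec (Group.Carrier G₁) m) (X : Vec (Group.Carrier G₂) (m + 2))
    where
    private
      module ₁ = Group G₁
      module ₂ = Group G₂
      module C₁ = Conjugation G₁
      module C₂ = Conjugation G₂
      module L₁ = OnLists G₁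
      module L₂ = OnLists G₂
    open GroupDefs G₁ using (gen; unit; inv; mul; resp; Span; NormalClosure) renaming (_^_ to _^₁_)
    open Closures G₁ R W
    open Nontriviality G₂
    open import Data.List.Relation.Unary.All using (All; []; _∷_; universal)
    open import Data.List.Relation.Unary.All.Properties using (map⁺; ++⁺)
    open import Data.List.Relation.Binary.Pointwise using (Pointwise; []; _∷_)
    open import Data.Vec.Relation.Unary.All.Properties using (lookup⁻; toList⁺)

    Everything : ₂.Carrier → Set ℓ₂
    Everything _ = Lift ℓ₂ ⊤

    Trivial : ₂.Carrier → Set ℓ₂
    Trivial x = x ₂.≈ ₂.ε

    everything : Lift ℓ₂ ⊤
    everything = lift tt

    trivial-∙ : ∀ {x y} → Trivial x → Trivial y → Trivial (x ₂.∙ y)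
    trivial-∙ x≈ε y≈ε = ₂.trans (₂.∙-cong x≈ε y≈ε) (₂.identityˡ ₂.ε)

    trivial-⁻¹ : ∀ {x} → Trivial x → Trivial (x ₂.⁻¹)
    trivial-⁻¹ x≈ε = ₂.trans (₂.⁻¹-cong x≈ε) (GroupProperties.ε⁻¹≈ε G₂)

    trivial-resp : ∀ {x y} → x ₂.≈ y → Trivial x → Trivial y
    trivial-resp x≈y x≈ε = ₂.trans (₂.sym x≈y) x≈ε

    trivial-^ : ∀ {x y} → Trivial x → Everything y → Trivial (GroupDefs._^_ G₂ x y)
    trivial-^ {y = y} x≈ε _ = ₂.trans (C₂.^-cong x≈ε ₂.refl) (C₂.ε-^ y)

    module T₁ = Tracking G₁ (Span R W) (NormalClosure R W) mul inv resp NormalClosure⊆Span mul inv resp NormalClosure-^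
    module T₂ = Tracking G₂ Everything Trivial (λ _ _ → everything) (λ _ → everything) (λ _ _ → everything)
                         (λ _ → everything) trivial-∙ trivial-⁻¹ trivial-resp trivial-^

    RL = V.toList R
    WL = V.toList W
    XL = V.toList X
    EL = map (λ _ → ₂.ε) RL

    V : ₁.Carrier → List ₁.Carrier
    V H = WL ++ H ₁.⁻¹ ∷ H ∷ []

    NConjugate : ₁.Carrier → ₁.Carrier → Set (c₁ ⊔ ℓ₁)
    NConjugate v a = ∃[ y ] (NormalClosure R W y × v ₁.≈ a ^₁ y)

    marked-strands : ∀ {ss u a v b} → T₁.Tracked ss u a → T₂.Tracked ss v b → All NonTrivial v →
                     L₂._≋_ v b × Pointwise NConjugate u a
    marked-strands T₁.[]                   T₂.[]                     []         = [] , []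
    marked-strands (T₁.relator _ _)        (T₂.relator v≈ε _)        (v≉ε ∷ _)  = ⊥-elim (v≉ε v≈ε)
    marked-strands (T₁.conj y _ ny u≈ tr₁) (T₂.conj z _ z≈ε v≈ tr₂) (_ ∷ ntv) =
      (₂.trans v≈ (C₂.^-≈ε z≈ε) ∷ proj₁ rest) , ((y , ny , u≈) ∷ proj₂ rest)
      where rest = marked-strands tr₁ tr₂ ntv

    relator-strands : ∀ Rs {ss u a v b} → T₁.Tracked ss (Rs ++ u) a → T₂.Tracked ss (map (λ _ → ₂.ε) Rs ++ v) b →
                      All NonTrivial v → All NonTrivial b → L₂._≋_ v b × Pointwise NConjugate u a
    relator-strands []       tr₁                   tr₂                      ntv ntb       = marked-strands tr₁ tr₂ ntv
    relator-strands (_ ∷ Rs) (T₁.relator _ tr₁)    (T₂.relator _ tr₂)       ntv ntb       = relator-strands Rs tr₁ tr₂ ntv ntb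
    relator-strands (_ ∷ Rs) (T₁.conj _ _ _ _ _)   (T₂.conj _ _ z≈ε ε≈ _)  ntv (b≉ε ∷ _) =
      ⊥-elim (b≉ε (₂.trans (₂.sym (C₂.^-≈ε z≈ε)) (₂.sym ε≈)))

    last-conjugate : ∀ Ws {u₁ u₂ a v₁ v₂} → Pointwise NConjugate (Ws ++ u₁ ∷ u₂ ∷ []) a →
                     L₁._≋_ a (Ws ++ v₁ ∷ v₂ ∷ []) → NConjugate u₂ v₂
    last-conjugate []       (_ ∷ (y , ny , u≈) ∷ []) (_ ∷ a≈v ∷ []) = y , ny , ₁.trans u≈ (C₁.^-cong a≈v ₁.refl)
    last-conjugate (_ ∷ Ws) (_ ∷ cs)                 (_ ∷ as)       = last-conjugate Ws cs as

    backward : ∀ {H H₁} ω → Span R W H → All NonTrivial XL →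
      (∀ ω → L₂._≋_ (L₂.actL ω XL) XL → L₁._≋_ (L₁.actL ω (V H)) (V H)) →
      L₁._≋_ (L₁.actL ω (RL ++ V H)) (RL ++ V H₁) → L₂._≋_ (L₂.actL ω (EL ++ XL)) (EL ++ XL) →
      ∃[ Y ] (NormalClosure R W Y × H ^₁ Y ₁.≈ H₁)
    backward {H} {H₁} ω sH ntX stabilizes ω-act₁ ω-act₂ = Y , nY , ₁.sym H₁≈H^Y
      where
      ss₀ = replicate (length RL) rel ++ replicate (length (V H)) mark
      same-strands : replicate (length EL) rel ++ replicate (length XL) mark ≡ ss₀
      same-strands = cong₂ (λ a b → replicate a rel ++ replicate b mark) (length-map _ RL)
                           (≡.trans (length-toList X) (≡.sym (≡.trans (length-++ WL) (cong (_+ 2) (length-toList W)))))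
      tracked₁ : T₁.Tracked ss₀ (RL ++ V H) (V H)
      tracked₁ = T₁.initially-tracked unit (toList⁺ (lookup⁻ {xs = R} R∈N))
                                           (++⁺ (toList⁺ (lookup⁻ {xs = W} W∈Span)) (inv sH ∷ sH ∷ []))
        where
        R∈N : ∀ i → NormalClosure R W (lookup R i)
        R∈N i = gen (i , ₁.ε , unit , ₁.sym (C₁.^-identityʳ _))
        W∈Span : ∀ j → Span R W (lookup W j)
        W∈Span j = gen (inj₂ (j , ₁.refl))
      tracked₂ : T₂.Tracked ss₀ (EL ++ XL) XL
      tracked₂ = ≡.subst (λ ss → T₂.Tracked ss (EL ++ XL) XL) same-strands
                         (T₂.initially-tracked ₂.refl (map⁺ (universal (λ _ → ₂.refl) RL)) (universal (λ _ → everything) XL))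
      ω′ = inducedWord ω ss₀
      extracted = relator-strands RL (T₁.tracked-resp (T₁.actL-tracked ω tracked₁) ω-act₁)
                                     (T₂.tracked-resp (T₂.actL-tracked ω tracked₂) ω-act₂)
                                     ntX (actL-nonTrivial ω′ ntX)
      conjugate = last-conjugate WL (proj₂ extracted) (stabilizes ω′ (L₂.≋-sym (proj₁ extracted)))
      Y = proj₁ conjugate
      nY = proj₁ (proj₂ conjugate)
      H₁≈H^Y = proj₂ (proj₂ conjugate)

  -- From lists back to vectors and braid generators

  module Projection {c₁ ℓ₁ c₂ ℓ₂} {K : Group c₁ ℓ₁} {L : Group c₂ ℓ₂} (f : Group.Carrier K → Group.Carrier L)
    (f-^ : ∀ x y → f (GroupDefs._^_ K x y) ≡ GroupDefs._^_ L (f x) (f y))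
    (f-σ⁻ : ∀ x y → f (Group._∙_ K (Group._∙_ K x y) (Group._⁻¹ K x))
                    ≡ Group._∙_ L (Group._∙_ L (f x) (f y)) (Group._⁻¹ L (f x)))
    where
    private
      module K = OnLists K
      module L = OnLists L

    map-σL : ∀ p v → map f (K.σL p v) ≡ L.σL p (map f v)
    map-σL zero    []          = ≡.refl
    map-σL zero    (x ∷ [])    = ≡.refl
    map-σL zero    (x ∷ y ∷ v) = cong (λ z → f y ∷ z ∷ map f v) (f-^ x y)
    map-σL (suc p) []          = ≡.refl
    map-σL (suc p) (x ∷ v)     = cong (f x ∷_) (map-σL p v)

    map-σL⁻ : ∀ p v → map f (K.σL⁻ p v) ≡ L.σL⁻ p (map f v)
    map-σL⁻ zero    []          = ≡.refl
    map-σL⁻ zero    (x ∷ [])    = ≡.refl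
    map-σL⁻ zero    (x ∷ y ∷ v) = cong (λ z → z ∷ f x ∷ map f v) (f-σ⁻ x y)
    map-σL⁻ (suc p) []          = ≡.refl
    map-σL⁻ (suc p) (x ∷ v)     = cong (f x ∷_) (map-σL⁻ p v)

    map-actL : ∀ w v → map f (K.actL w v) ≡ L.actL w (map f v)
    map-actL []                v = ≡.refl
    map-actL ((p , true)  ∷ w) v = ≡.trans (map-actL w (K.σL p v)) (cong (L.actL w) (map-σL p v))
    map-actL ((p , false) ∷ w) v = ≡.trans (map-actL w (K.σL⁻ p v)) (cong (L.actL w) (map-σL⁻ p v))

  position : ∀ {k} → BGen k → ℕ
  position here      = 0
  position (there i) = suc (position i)

  toWord : ∀ {k} → BraidWord k → Word
  toWord = map (map₁ position)

  generatorWord : ∀ k → ℕ × Bool → BraidWord k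
  generatorWord (suc (suc k)) (zero  , b) = (here , b) ∷ []
  generatorWord (suc (suc k)) (suc p , b) = map (map₁ there) (generatorWord (suc k) (p , b))
  generatorWord _             _           = []

  fromWord : ∀ {k} → Word → BraidWord k
  fromWord     []      = []
  fromWord {k} (x ∷ ω) = generatorWord k x ++ fromWord ω

  module Bridge {c ℓ} (K : Group c ℓ) where
    open Group K
    open GroupDefs K using (σ; σ⁻; act) renaming (_≋_ to _≋ᵛ_)
    open OnLists K
    import Data.Vec.Relation.Binary.Pointwise.Inductive as VecPointwise

    toList-σ : ∀ {k} (i : BGen k) v → V.toList (σ i v) ≡ σL (position i) (V.toList v)
    toList-σ here      (f V.∷ g V.∷ v) = ≡.refl
    toList-σ (there i) (f V.∷ v)       = cong (f ∷_) (toList-σ i v)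

    toList-σ⁻ : ∀ {k} (i : BGen k) v → V.toList (σ⁻ i v) ≡ σL⁻ (position i) (V.toList v)
    toList-σ⁻ here      (f V.∷ g V.∷ v) = ≡.refl
    toList-σ⁻ (there i) (f V.∷ v)       = cong (f ∷_) (toList-σ⁻ i v)

    toList-act : ∀ {k} (w : BraidWord k) v → V.toList (act w v) ≡ actL (toWord w) (V.toList v)
    toList-act []                v = ≡.refl
    toList-act ((i , true)  ∷ w) v = ≡.trans (toList-act w (σ i v)) (cong (actL (toWord w)) (toList-σ i v))
    toList-act ((i , false) ∷ w) v = ≡.trans (toList-act w (σ⁻ i v)) (cong (actL (toWord w)) (toList-σ⁻ i v))

    act-++ : ∀ {k} (w w′ : BraidWord k) v → act (w ++ w′) v ≡ act w′ (act w v)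
    act-++ []                w′ v = ≡.refl
    act-++ ((i , true)  ∷ w) w′ v = act-++ w w′ (σ i v)
    act-++ ((i , false) ∷ w) w′ v = act-++ w w′ (σ⁻ i v)

    act-there : ∀ {k} (w : BraidWord k) f v → act (map (map₁ there) w) (f V.∷ v) ≡ f V.∷ act w v
    act-there []                f v = ≡.refl
    act-there ((i , true)  ∷ w) f v = act-there w f (σ i v)
    act-there ((i , false) ∷ w) f v = act-there w f (σ⁻ i v)

    letter-[] : ∀ x → letter x [] ≡ []
    letter-[] (zero  , true)  = ≡.refl
    letter-[] (zero  , false) = ≡.refl
    letter-[] (suc p , true)  = ≡.refl
    letter-[] (suc p , false) = ≡.refl

    letter-suc : ∀ p b f v → letter (suc p , b) (f ∷ v) ≡ f ∷ letter (p , b) v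
    letter-suc p true  f v = ≡.refl
    letter-suc p false f v = ≡.refl

    toList-act-generatorWord : ∀ k x (v : Vec Carrier k) → V.toList (act (generatorWord k x) v) ≡ letter x (V.toList v)
    toList-act-generatorWord zero          x             V.[]              = ≡.sym (letter-[] x)
    toList-act-generatorWord (suc zero)    (zero , true)  (f V.∷ V.[])     = ≡.refl
    toList-act-generatorWord (suc zero)    (zero , false) (f V.∷ V.[])     = ≡.refl
    toList-act-generatorWord (suc zero)    (suc p , b)   (f V.∷ V.[])      =
      ≡.sym (≡.trans (letter-suc p b f []) (cong (f ∷_) (letter-[] (p , b))))
    toList-act-generatorWord (suc (suc k)) (zero , true)  (f V.∷ g V.∷ v)  = ≡.refl
    toList-act-generatorWord (suc (suc k)) (zero , false) (f V.∷ g V.∷ v)  = ≡.refl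
    toList-act-generatorWord (suc (suc k)) (suc p , b)   (f V.∷ v)         =
      ≡.trans (cong V.toList (act-there (generatorWord (suc k) (p , b)) f v))
     (≡.trans (cong (f ∷_) (toList-act-generatorWord (suc k) (p , b) v)) (≡.sym (letter-suc p b f (V.toList v))))

    toList-act-fromWord : ∀ {k} ω (v : Vec Carrier k) → V.toList (act (fromWord ω) v) ≡ actL ω (V.toList v)
    toList-act-fromWord         []      v = ≡.refl
    toList-act-fromWord {k = k} (x ∷ ω) v =
      ≡.trans (cong V.toList (act-++ (generatorWord k x) (fromWord ω) v))
     (≡.trans (toList-act-fromWord ω (act (generatorWord k x) v)) (cong (actL ω) (toList-act-generatorWord k x v)))

    ≋ᵛ⇒≋ : ∀ {k} {u v : Vec Carrier k} → u ≋ᵛ v → V.toList u ≋ V.toList v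
    ≋ᵛ⇒≋ VecPointwise.[]         = []
    ≋ᵛ⇒≋ (u≈v VecPointwise.∷ us) = u≈v ∷ ≋ᵛ⇒≋ us

    ≋⇒≋ᵛ : ∀ {k} {u v : Vec Carrier k} → V.toList u ≋ V.toList v → u ≋ᵛ v
    ≋⇒≋ᵛ {u = V.[]}    {V.[]}    []          = VecPointwise.[]
    ≋⇒≋ᵛ {u = _ V.∷ _} {_ V.∷ _} (u≈v ∷ us) = u≈v VecPointwise.∷ ≋⇒≋ᵛ us

    hurwitzEquivalent⇒∼ : ∀ {k} {u v : Vec Carrier k} → GroupDefs.HurwitzEquivalent K u v → V.toList u ∼ V.toList v
    hurwitzEquivalent⇒∼ {u = u} (w , wu≋v) = toWord w , ≋-trans (≋-reflexive (≡.sym (toList-act w u))) (≋ᵛ⇒≋ wu≋v)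

    ∼⇒hurwitzEquivalent : ∀ {k} {u v : Vec Carrier k} → V.toList u ∼ V.toList v → GroupDefs.HurwitzEquivalent K u v
    ∼⇒hurwitzEquivalent {u = u} (ω , ωu≋v) = fromWord ω , ≋⇒≋ᵛ (≋-trans (≋-reflexive (toList-act-fromWord ω u)) ωu≋v)

  module Factorization {c₁ ℓ₁ c₂ ℓ₂} (G₁ : Group c₁ ℓ₁) (G₂ : Group c₂ ℓ₂) {n m}
    (R : Vec (Group.Carrier G₁) n) (W : Vec (Group.Carrier G₁) m) (X : Vec (Group.Carrier G₂) (m + 2))
    where
    private
      module ₁ = Group G₁
      module ₂ = Group G₂
      module L₁ = OnLists G₁
      module L₂ = OnLists G₂
      module B₁ = Bridge G₁
      module B₂ = Bridge G₂
    open OnLists (G₁⊕G₂ G₁ G₂)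
    open VecProperties using (toList-++; toList-map; map-proj₁-zip; map-proj₂-zip; zipWith-++)
    open ≡.≡-Reasoning
    import Data.List.Relation.Binary.Equality.Setoid as ListEquality

    ι : ₁.Carrier → ₁.Carrier × ₂.Carrier
    ι r = (r , ₂.ε)

    pairs : ₁.Carrier → Vec ₁.Carrier (m + 2)
    pairs H = W V.++ H ₁.⁻¹ V.∷ H V.∷ V.[]

    PL : ₁.Carrier → List (₁.Carrier × ₂.Carrier)
    PL H = V.toList (P G₁ G₂ R W X H)

    W∈zip : ∀ {Xm : Vec ₂.Carrier m} j → ∃[ x ] ((lookup W j , x) ∈ V.toList (V.zip W Xm))
    W∈zip {Xm} j =
      lookup Xm j , ∈-toList⁺ (≡.subst (_∈ᵥ V.zip W Xm) (VecProperties.lookup-zipWith _,_ j W Xm) (∈-lookup j (V.zip W Xm)))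

    PL-shape : ∀ {Xm x₁ x₂} → X ≡ Xm V.++ x₁ V.∷ x₂ V.∷ V.[] → ∀ H →
               PL H ≡ map ι (V.toList R) ++ V.toList (V.zip W Xm) ++ (H ₁.⁻¹ , x₁) ∷ (H , x₂) ∷ []
    PL-shape {Xm} {x₁} {x₂} X≡ H = begin
      V.toList (V.map ι R V.++ V.zip (pairs H) X)
        ≡⟨ toList-++ (V.map ι R) _ ⟩
      V.toList (V.map ι R) ++ V.toList (V.zip (pairs H) X)
        ≡⟨ cong₂ _++_ (toList-map ι R) (cong (λ Y → V.toList (V.zip (pairs H) Y)) X≡) ⟩
      map ι (V.toList R) ++ V.toList (V.zip (pairs H) (Xm V.++ x₁ V.∷ x₂ V.∷ V.[]))
        ≡⟨ cong (λ Y → map ι (V.toList R) ++ V.toList Y) (zipWith-++ _,_ W _ Xm _) ⟩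
      map ι (V.toList R) ++ V.toList (V.zip W Xm V.++ (H ₁.⁻¹ , x₁) V.∷ (H , x₂) V.∷ V.[])
        ≡⟨ cong (map ι (V.toList R) ++_) (toList-++ (V.zip W Xm) _) ⟩
      map ι (V.toList R) ++ V.toList (V.zip W Xm) ++ (H ₁.⁻¹ , x₁) ∷ (H , x₂) ∷ []
        ∎

    proj₁-PL : ∀ H → map proj₁ (PL H) ≡ V.toList R ++ V.toList W ++ H ₁.⁻¹ ∷ H ∷ []
    proj₁-PL H = begin
      map proj₁ (PL H)
        ≡⟨ toList-map proj₁ _ ⟨
      V.toList (V.map proj₁ (V.map ι R V.++ V.zip (pairs H) X))
        ≡⟨ cong V.toList (VecProperties.map-++ proj₁ (V.map ι R) _) ⟩
      V.toList (V.map proj₁ (V.map ι R) V.++ V.map proj₁ (V.zip (pairs H) X))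
        ≡⟨ cong₂ (λ A B → V.toList (A V.++ B)) (≡.trans (≡.sym (VecProperties.map-∘ proj₁ ι R)) (VecProperties.map-id R))
                 (map-proj₁-zip (pairs H) X) ⟩
      V.toList (R V.++ pairs H)
        ≡⟨ toList-++ R (pairs H) ⟩
      V.toList R ++ V.toList (pairs H)
        ≡⟨ cong (V.toList R ++_) (toList-++ W _) ⟩
      V.toList R ++ V.toList W ++ H ₁.⁻¹ ∷ H ∷ []
        ∎

    proj₂-PL : ∀ H → map proj₂ (PL H) ≡ map (λ _ → ₂.ε) (V.toList R) ++ V.toList X
    proj₂-PL H = begin
      map proj₂ (PL H)
        ≡⟨ toList-map proj₂ _ ⟨
      V.toList (V.map proj₂ (V.map ι R V.++ V.zip (pairs H) X))
        ≡⟨ cong V.toList (VecProperties.map-++ proj₂ (V.map ι R) _) ⟩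
      V.toList (V.map proj₂ (V.map ι R) V.++ V.map proj₂ (V.zip (pairs H) X))
        ≡⟨ cong₂ (λ A B → V.toList (A V.++ B)) (≡.sym (VecProperties.map-∘ proj₂ ι R)) (map-proj₂-zip (pairs H) X) ⟩
      V.toList (V.map (λ _ → ₂.ε) R V.++ X)
        ≡⟨ toList-++ (V.map (λ _ → ₂.ε) R) X ⟩
      V.toList (V.map (λ _ → ₂.ε) R) ++ V.toList X
        ≡⟨ cong (_++ V.toList X) (toList-map (λ _ → ₂.ε) R) ⟩
      map (λ _ → ₂.ε) (V.toList R) ++ V.toList X
        ∎

    module Projection₁ = Projection {K = G₁⊕G₂ G₁ G₂} {L = G₁} proj₁ (λ _ _ → ≡.refl) (λ _ _ → ≡.refl)
    module Projection₂ = Projection {K = G₁⊕G₂ G₁ G₂} {L = G₂} proj₂ (λ _ _ → ≡.refl) (λ _ _ → ≡.refl)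

    first-coordinates : ∀ {H H₁} ω → actL ω (PL H) ≋ PL H₁ →
      L₁._≋_ (L₁.actL ω (V.toList R ++ V.toList W ++ H ₁.⁻¹ ∷ H ∷ [])) (V.toList R ++ V.toList W ++ H₁ ₁.⁻¹ ∷ H₁ ∷ [])
    first-coordinates {H} {H₁} ω ωP≋P =
      L₁.≋-trans (L₁.≋-reflexive projected)
     (L₁.≋-trans (ListEquality.map⁺ (Group.setoid (G₁⊕G₂ G₁ G₂)) ₁.setoid proj₁ ωP≋P) (L₁.≋-reflexive (proj₁-PL H₁)))
      where
      projected : L₁.actL ω (V.toList R ++ V.toList W ++ H ₁.⁻¹ ∷ H ∷ []) ≡ map proj₁ (actL ω (PL H))
      projected = ≡.trans (cong (L₁.actL ω) (≡.sym (proj₁-PL H))) (≡.sym (Projection₁.map-actL ω (PL H)))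

    second-coordinates : ∀ {H H₁} ω → actL ω (PL H) ≋ PL H₁ →
      L₂._≋_ (L₂.actL ω (map (λ _ → ₂.ε) (V.toList R) ++ V.toList X)) (map (λ _ → ₂.ε) (V.toList R) ++ V.toList X)
    second-coordinates {H} {H₁} ω ωP≋P =
      L₂.≋-trans (L₂.≋-reflexive projected)
     (L₂.≋-trans (ListEquality.map⁺ (Group.setoid (G₁⊕G₂ G₁ G₂)) ₂.setoid proj₂ ωP≋P) (L₂.≋-reflexive (proj₂-PL H₁)))
      where
      projected : L₂.actL ω (map (λ _ → ₂.ε) (V.toList R) ++ V.toList X) ≡ map proj₂ (actL ω (PL H))
      projected = ≡.trans (cong (L₂.actL ω) (≡.sym (proj₂-PL H))) (≡.sym (Projection₂.map-actL ω (PL H)))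

    stabilizer-lists : ∀ {H} → (∀ w → GroupDefs.Stabilizes G₂ w X → GroupDefs.Stabilizes G₁ w (pairs H)) →
      ∀ ω → L₂._≋_ (L₂.actL ω (V.toList X)) (V.toList X) →
      L₁._≋_ (L₁.actL ω (V.toList W ++ H ₁.⁻¹ ∷ H ∷ [])) (V.toList W ++ H ₁.⁻¹ ∷ H ∷ [])
    stabilizer-lists {H} stabilizer ω ωX≋X = ≡.subst (λ L → L₁._≋_ (L₁.actL ω L) L) (toList-++ W _)
      (L₁.≋-trans (L₁.≋-reflexive (≡.sym (B₁.toList-act-fromWord ω (pairs H))))
                  (B₁.≋ᵛ⇒≋ (stabilizer (fromWord ω) (B₂.≋⇒≋ᵛ X-fixed))))
      where
      X-fixed : L₂._≋_ (V.toList (GroupDefs.act G₂ (fromWord ω) X)) (V.toList X)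
      X-fixed = L₂.≋-trans (L₂.≋-reflexive (B₂.toList-act-fromWord ω X)) ωX≋X

open import Data.Vec using ([]; _∷_; _++_; toList; zip; splitAt)
open import Data.Vec.Relation.Unary.All.Properties using (lookup⁻; toList⁺)
open import Function.Bundles using (_⇔_; mk⇔)
open HurwitzAction

corollary3p6 : ∀ {c₁ ℓ₁ c₂ ℓ₂} (G₁ : Group c₁ ℓ₁) (G₂ : Group c₂ ℓ₂) (n m : ℕ)
    (R : Vec (Group.Carrier G₁) n) (W : Vec (Group.Carrier G₁) m)
    (H H₁ : Group.Carrier G₁) (X : Vec (Group.Carrier G₂) (m + 2)) →
    Group._≈_ G₁ (GroupDefs.prod G₁ R) (Group.ε G₁) →
    GroupDefs.Span G₁ R W H →
    (∀ i → ¬ Group._≈_ G₂ (lookup X i) (Group.ε G₂)) →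
    (∀ w → GroupDefs.Stabilizes G₂ w X →
      GroupDefs.Stabilizes G₁ w (W ++ (Group._⁻¹ G₁ H ∷ H ∷ []))) →
    ((∃[ Y ] (GroupDefs.NormalClosure G₁ R W Y × Group._≈_ G₁ (GroupDefs._^_ G₁ H Y) H₁))
      ⇔ GroupDefs.HurwitzEquivalent (G₁⊕G₂ G₁ G₂) (P G₁ G₂ R W X H) (P G₁ G₂ R W X H₁))
corollary3p6 G₁ G₂ n m R W H H₁ X ∏R≈ε H∈Span X≉ε stabilizer with splitAt m X
... | Xm , x₁ ∷ x₂ ∷ [] , X≡ = mk⇔ hurwitzEquivalent normalClosureConjugate
  where
  open OnLists (G₁⊕G₂ G₁ G₂)
  open Factorization G₁ G₂ R W X
  module F = Forward G₁ G₂ R W ∏R≈ε (toList (zip W Xm)) W∈zip x₁ x₂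
  P≋Q : ∀ H → PL H ≋ F.Q H
  P≋Q H = ≋-trans (≋-reflexive (PL-shape X≡ H)) (F.Q-unfold H)
  hurwitzEquivalent : ∃[ Y ] (GroupDefs.NormalClosure G₁ R W Y × Group._≈_ G₁ (GroupDefs._^_ G₁ H Y) H₁) →
                      GroupDefs.HurwitzEquivalent (G₁⊕G₂ G₁ G₂) (P G₁ G₂ R W X H) (P G₁ G₂ R W X H₁)
  hurwitzEquivalent (Y , nY , H^Y≈H₁) =
    Bridge.∼⇒hurwitzEquivalent (G₁⊕G₂ G₁ G₂)
      (∼-respˡ (≋-sym (P≋Q H)) (∼-respʳ (≋-sym (P≋Q H₁)) (F.forward nY H^Y≈H₁)))
  normalClosureConjugate : GroupDefs.HurwitzEquivalent (G₁⊕G₂ G₁ G₂) (P G₁ G₂ R W X H) (P G₁ G₂ R W X H₁) →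
                           ∃[ Y ] (GroupDefs.NormalClosure G₁ R W Y × Group._≈_ G₁ (GroupDefs._^_ G₁ H Y) H₁)
  normalClosureConjugate hurwitz with Bridge.hurwitzEquivalent⇒∼ (G₁⊕G₂ G₁ G₂) hurwitz
  ... | ω , ωP≋P = Backward.backward G₁ G₂ R W X ω H∈Span (toList⁺ (lookup⁻ X≉ε)) (stabilizer-lists stabilizer)
                     (first-coordinates ω ωP≋P) (second-coordinates ω ωP≋P)
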